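{- Let $A$ be a regular system of divisors and $n\in\mathbb N$. Then \[ \Phi_{A,n}(x)=\Phi_{A,\kappa_A(n)}\!\left(x^{n/\kappa_A(n)}\right). \]
   Context: A regular system of divisors is a family $A=(A(n))_{n\in\mathbb N}$, where each $A(n)$ is a set of positive divisors of $n$, such that: (i) $A(1)=\{1\}$ and $A(mn)=\{de: d\in A(m), e\in A(n)\}$ whenever $\gcd(m,n)=1$; (ii) for every prime power $p^a$ ($a\ge1$) there is a divisor $t=t_A(p^a)$ of $a$ (the type of $p^a$) such that $A(p^{it})=\{1,p^t,\dots,p^{it}\}$ for every $0\le i\le a/t$. For $j\in\mathbb Z$, $(j,n)_A=\max\{d\in\mathbb N: d\mid j,\ d\in A(n)\}$; $\zeta_n=e^{2\pi i/n}$; $\Phi_{A,n}(x)=\prod_{1\le j\le n,\ (j,n)_A=1}(x-\zeta_n^j)$. The $A$-kernel is $\kappa_A(n)=\prod_{p^a\parallel n}p^{t_A(p^a)}$, the product over the prime powers exactly dividing $n$. -}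

module Defs where

open import Level using (Level; _⊔_)
open import Data.Nat as ℕ using (ℕ; zero; suc; _≤_; _<_; _≟_)
open import Data.Nat.Divisibility using (_∣_; _∣?_)
open import Data.Nat.Coprimality using (Coprime)
open import Data.Nat.Primality using (Prime; prime?)
open import Data.List using (List; []; _∷_; map; filter; foldr; length; upTo; replicate; _++_)
open import Data.Nat.ListAction using (product)
open import Data.Product using (Σ; ∃; _×_; _,_)
open import Data.Sum using (_⊎_)
open import Relation.Nullary using (Dec; ¬_)
open import Relation.Nullary.Decidable using (_×-dec_)
open import Relation.Binary.PropositionalEquality using (_≡_)
open import Algebra.Bundles using (CommutativeRing)

-- Regular systems of divisors.
-- In n d  means  d ∈ A(n).  Membership is assumed decidable (each A(n)
-- is a finite set of divisors of n).

range1 : ℕ → List ℕ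
range1 n = map suc (upTo n)

record RegularSystem : Set₁ where
  field
    In     : ℕ → ℕ → Set
    In?    : ∀ n d → Dec (In n d)
    In-pos : ∀ {n d} → In n d → 1 ≤ d
    In-∣   : ∀ {n d} → In n d → d ∣ n
    one    : ∀ d → (In 1 d → d ≡ 1) × (d ≡ 1 → In 1 d)
    mult   : ∀ m n → 1 ≤ m → 1 ≤ n → Coprime m n → ∀ c →
             (In (m ℕ.* n) c → ∃ λ d → ∃ λ e → In m d × In n e × c ≡ d ℕ.* e)
           × ((∃ λ d → ∃ λ e → In m d × In n e × c ≡ d ℕ.* e) → In (m ℕ.* n) c)
    type   : ℕ → ℕ → ℕ       -- type p a = t_A(p^a)
    type-∣ : ∀ p a → Prime p → 1 ≤ a → type p a ∣ a
    type-spec : ∀ p a → Prime p → 1 ≤ a → ∀ i → i ℕ.* type p a ≤ a → ∀ d →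
             (In (p ℕ.^ (i ℕ.* type p a)) d → ∃ λ r → r ≤ i × d ≡ p ℕ.^ (r ℕ.* type p a))
           × ((∃ λ r → r ≤ i × d ≡ p ℕ.^ (r ℕ.* type p a)) → In (p ℕ.^ (i ℕ.* type p a)) d)

module _ (A : RegularSystem) where
  open RegularSystem A

  -- (j , n)_A = max { d : d ∣ j , d ∈ A(n) }   (all such d are ≤ n for n ≥ 1)
  gcdA : ℕ → ℕ → ℕ
  gcdA j n = foldr ℕ._⊔_ 0 (filter (λ d → (d ∣? j) ×-dec In? n d) (range1 n))

  -- p-adic valuation of n ≥ 1 (p prime): number of a ∈ {1..n} with p^a ∣ n
  val : ℕ → ℕ → ℕ
  val p n = length (filter (λ a → (p ℕ.^ a) ∣? n) (range1 n))

  kappa : ℕ → ℕ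
  kappa n = product (map (λ p → p ℕ.^ type p (val p n))
                         (filter (λ p → prime? p ×-dec (p ∣? n)) (range1 n)))

-- Polynomials over a commutative ring, as coefficient lists (constant
-- term first); equality is coefficientwise (trailing zeros irrelevant).

module Poly {c ℓ : Level} (R : CommutativeRing c ℓ) where
  open CommutativeRing R

  Pol : Set c
  Pol = List Carrier

  pow : Carrier → ℕ → Carrier
  pow x zero    = 1#
  pow x (suc k) = x * pow x k

  _+P_ : Pol → Pol → Pol
  []       +P q        = q
  (a ∷ p)  +P []       = a ∷ p
  (a ∷ p)  +P (b ∷ q)  = (a + b) ∷ (p +P q)

  scale : Carrier → Pol → Pol
  scale a = map (a *_)

  _*P_ : Pol → Pol → Pol
  p *P q = foldr (λ a acc → scale a q +P (0# ∷ acc)) [] p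

  oneP : Pol
  oneP = 1# ∷ []

  prodP : List Pol → Pol
  prodP = foldr _*P_ oneP

  linear : Carrier → Pol
  linear a = (- a) ∷ 1# ∷ []

  xpow : ℕ → Pol
  xpow m = replicate m 0# ++ (1# ∷ [])

  compose : Pol → Pol → Pol
  compose p q = foldr (λ a acc → (a ∷ []) +P (q *P acc)) [] p

  coeff : Pol → ℕ → Carrier
  coeff []      _       = 0#
  coeff (a ∷ p) zero    = a
  coeff (a ∷ p) (suc i) = coeff p i

  _≈P_ : Pol → Pol → Set ℓ
  p ≈P q = ∀ i → coeff p i ≈ coeff q i

  IsDomain : Set (c ⊔ ℓ)
  IsDomain = (¬ (1# ≈ 0#)) × (∀ x y → x * y ≈ 0# → x ≈ 0# ⊎ y ≈ 0#)

  IsPrimitiveRoot : ℕ → Carrier → Set ℓ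
  IsPrimitiveRoot n ζ = (pow ζ n ≈ 1#) × (∀ d → 1 ≤ d → d < n → ¬ (pow ζ d ≈ 1#))

  -- Φ_{A,n}(x) = ∏_{1≤j≤n, (j,n)_A = 1} (x - ζ^j), with ζ playing ζ_n
  PhiA : RegularSystem → Carrier → ℕ → Pol
  PhiA A ζ n = prodP (map (λ j → linear (pow ζ j))
                          (filter (λ j → gcdA A j n ≟ 1) (range1 n)))

-- Write κ = κ_A(n) and n = κ m. Whether (j , n)_A = 1 depends only on which prime powers
-- p^{t_A(pᵃ)} (pᵃ ∥ n) divide j; these all divide κ and keep their types in κ, so
-- (j + κ k , n)_A = 1 iff (j , κ)_A = 1. Hence the j ≤ n with (j , n)_A = 1 are the j + κ k
-- with j ≤ κ, (j , κ)_A = 1 and k < m, and grouping the factors of Φ_{A,n} by j leaves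
-- ∏_{k<m} (x − ζ^{j+κk}) = xᵐ − ζ^{mj}, because ζ^κ is a primitive m-th root of unity.
module Submission where

open import Level using (Level)
open import Algebra.Bundles using (CommutativeRing; CommutativeMonoid)
open import Algebra.Structures using (IsCommutativeMonoid)
import Algebra.Properties.CommutativeSemigroup as CommSemigroupProperties
import Algebra.Properties.Ring as RingProperties
import Algebra.Properties.Semiring.Exp as SemiringExp
open import Data.Nat as ℕ using (ℕ; zero; suc; _<_; s≤s; z≤n)
import Data.Nat.Properties as ℕ
open import Data.List
  using (List; []; _∷_; map; foldr; filter; upTo; applyUpTo; cartesianProductWith; length; _++_; [_]; _∷ʳ_)
import Data.List.Properties as List
open import Data.List.Relation.Binary.Permutation.Propositional
  using (_↭_; ↭⇒↭ₛ′)
import Data.List.Relation.Binary.Permutation.Propositional.Properties as ↭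
open import Data.List.Relation.Binary.Permutation.Setoid.Properties
  using (foldr-commMonoid)
open import Data.Product using (_×_; _,_; proj₁; proj₂)
open import Data.Sum using (_⊎_; inj₁; inj₂)
open import Data.Empty using (⊥-elim)
open import Relation.Binary.Definitions using (tri<; tri≈; tri>)
open import Function using (_∘_)
open import Relation.Nullary using (¬_)
open import Relation.Binary.Bundles using (Setoid)
open import Relation.Binary.Structures using (IsEquivalence)
open import Relation.Binary.PropositionalEquality as ≡ using (_≡_; _≢_)
import Relation.Binary.Reasoning.Setoid as SetoidReasoning

open import Defs

module PolynomialArithmetic {c ℓ : Level} (R : CommutativeRing c ℓ) where

  open CommutativeRing R hiding (zero)
  open Poly R
  open CommSemigroupProperties *-commutativeSemigroup using (x∙yz≈y∙xz)
  open SemiringExp semiring using (_^_; ^-homo-*; ^-assocʳ)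
  module ≈-Reasoning = SetoidReasoning setoid

  -- Wrapping _≈P_ in a record lets Agda infer both polynomials from an equality proof.
  infix 4 _≋_
  record _≋_ (p q : Pol) : Set ℓ where
    constructor mk
    field get : p ≈P q
  open _≋_ public

  ≋-refl : ∀ {p} → p ≋ p
  ≋-refl = mk λ _ → refl

  ≋-sym : ∀ {p q} → p ≋ q → q ≋ p
  ≋-sym (mk e) = mk λ i → sym (e i)

  ≋-trans : ∀ {p q r} → p ≋ q → q ≋ r → p ≋ r
  ≋-trans (mk e) (mk f) = mk λ i → trans (e i) (f i)

  ≋-reflexive : ∀ {p q} → p ≡ q → p ≋ q
  ≋-reflexive ≡.refl = ≋-refl

  ≋-isEquivalence : IsEquivalence _≋_
  ≋-isEquivalence = record { refl = ≋-refl ; sym = ≋-sym ; trans = ≋-trans }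

  ≋-setoid : Setoid c ℓ
  ≋-setoid = record { isEquivalence = ≋-isEquivalence }

  module ≋-Reasoning = SetoidReasoning ≋-setoid

  ∷-cong : ∀ {a b p q} → a ≈ b → p ≋ q → (a ∷ p) ≋ (b ∷ q)
  ∷-cong a≈b (mk e) = mk λ { zero → a≈b ; (suc i) → e i }

  ∷-injectiveʳ : ∀ {a b p q} → (a ∷ p) ≋ (b ∷ q) → p ≋ q
  ∷-injectiveʳ (mk e) = mk λ i → e (suc i)

  ∷≋[]⇒≋[] : ∀ {a p} → (a ∷ p) ≋ [] → p ≋ []
  ∷≋[]⇒≋[] (mk e) = mk λ i → e (suc i)

  0∷[]≋[] : (0# ∷ []) ≋ []
  0∷[]≋[] = mk λ { zero → refl ; (suc i) → refl }

  0∷-≋[] : ∀ {p} → p ≋ [] → (0# ∷ p) ≋ []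
  0∷-≋[] p≋[] = ≋-trans (∷-cong refl p≋[]) 0∷[]≋[]

  coeff-+P : ∀ p q i → coeff (p +P q) i ≈ coeff p i + coeff q i
  coeff-+P []      q       i       = sym (+-identityˡ _)
  coeff-+P (a ∷ p) []      i       = sym (+-identityʳ _)
  coeff-+P (a ∷ p) (b ∷ q) zero    = refl
  coeff-+P (a ∷ p) (b ∷ q) (suc i) = coeff-+P p q i

  coeff-scale : ∀ a p i → coeff (scale a p) i ≈ a * coeff p i
  coeff-scale a []      i       = sym (zeroʳ a)
  coeff-scale a (b ∷ p) zero    = refl
  coeff-scale a (b ∷ p) (suc i) = coeff-scale a p i

  +P-cong : ∀ {p p′ q q′} → p ≋ p′ → q ≋ q′ → (p +P q) ≋ (p′ +P q′)
  +P-cong {p} {p′} {q} {q′} (mk e) (mk f) = mk λ i →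
    trans (coeff-+P p q i) (trans (+-cong (e i) (f i)) (sym (coeff-+P p′ q′ i)))

  +P-congˡ : ∀ p {q q′} → q ≋ q′ → (p +P q) ≋ (p +P q′)
  +P-congˡ p = +P-cong {p} ≋-refl

  +P-comm : ∀ p q → (p +P q) ≋ (q +P p)
  +P-comm p q = mk λ i →
    trans (coeff-+P p q i) (trans (+-comm _ _) (sym (coeff-+P q p i)))

  +P-assoc : ∀ p q r → ((p +P q) +P r) ≋ (p +P (q +P r))
  +P-assoc p q r = mk λ i → begin
    coeff ((p +P q) +P r) i              ≈⟨ coeff-+P (p +P q) r i ⟩
    coeff (p +P q) i + coeff r i         ≈⟨ +-congʳ (coeff-+P p q i) ⟩
    coeff p i + coeff q i + coeff r i    ≈⟨ +-assoc _ _ _ ⟩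
    coeff p i + (coeff q i + coeff r i)  ≈⟨ +-congˡ (coeff-+P q r i) ⟨
    coeff p i + coeff (q +P r) i         ≈⟨ coeff-+P p (q +P r) i ⟨
    coeff (p +P (q +P r)) i              ∎
    where open ≈-Reasoning

  +P-identityʳ : ∀ p → (p +P []) ≋ p
  +P-identityʳ []      = ≋-refl
  +P-identityʳ (a ∷ p) = ≋-refl

  +P-isCommutativeMonoid : IsCommutativeMonoid _≋_ _+P_ []
  +P-isCommutativeMonoid = record
    { isMonoid = record
      { isSemigroup = record
        { isMagma = record { isEquivalence = ≋-isEquivalence ; ∙-cong = +P-cong }
        ; assoc = +P-assoc }
      ; identity = (λ _ → ≋-refl) , +P-identityʳ }
    ; comm = +P-comm }

  +P-commutativeMonoid : CommutativeMonoid c ℓ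
  +P-commutativeMonoid = record { isCommutativeMonoid = +P-isCommutativeMonoid }

  open CommSemigroupProperties (CommutativeMonoid.commutativeSemigroup +P-commutativeMonoid)
    using () renaming (interchange to +P-interchange)

  0∷-+P : ∀ p q → (0# ∷ (p +P q)) ≋ ((0# ∷ p) +P (0# ∷ q))
  0∷-+P p q = ∷-cong (sym (+-identityʳ 0#)) ≋-refl

  ∷-as-+P : ∀ a p → (a ∷ p) ≋ ((a ∷ []) +P (0# ∷ p))
  ∷-as-+P a p = mk λ { zero → sym (+-identityʳ a) ; (suc i) → refl }

  scale-cong : ∀ {a b p q} → a ≈ b → p ≋ q → scale a p ≋ scale b q
  scale-cong {a} {b} {p} {q} a≈b (mk e) = mk λ i →
    trans (coeff-scale a p i) (trans (*-cong a≈b (e i)) (sym (coeff-scale b q i)))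

  scale-distribˡ : ∀ a p q → scale a (p +P q) ≋ (scale a p +P scale a q)
  scale-distribˡ a p q = mk λ i → begin
    coeff (scale a (p +P q)) i                 ≈⟨ coeff-scale a (p +P q) i ⟩
    a * coeff (p +P q) i                       ≈⟨ *-congˡ (coeff-+P p q i) ⟩
    a * (coeff p i + coeff q i)                ≈⟨ distribˡ _ _ _ ⟩
    a * coeff p i + a * coeff q i              ≈⟨ +-cong (coeff-scale a p i) (coeff-scale a q i) ⟨
    coeff (scale a p) i + coeff (scale a q) i  ≈⟨ coeff-+P (scale a p) (scale a q) i ⟨
    coeff (scale a p +P scale a q) i           ∎
    where open ≈-Reasoning

  scale-distribʳ : ∀ a b p → scale (a + b) p ≋ (scale a p +P scale b p)
  scale-distribʳ a b p = mk λ i → begin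
    coeff (scale (a + b) p) i                  ≈⟨ coeff-scale (a + b) p i ⟩
    (a + b) * coeff p i                        ≈⟨ distribʳ _ _ _ ⟩
    a * coeff p i + b * coeff p i              ≈⟨ +-cong (coeff-scale a p i) (coeff-scale b p i) ⟨
    coeff (scale a p) i + coeff (scale b p) i  ≈⟨ coeff-+P (scale a p) (scale b p) i ⟨
    coeff (scale a p +P scale b p) i           ∎
    where open ≈-Reasoning

  scale-scale : ∀ a b p → scale a (scale b p) ≋ scale (a * b) p
  scale-scale a b p = mk λ i → begin
    coeff (scale a (scale b p)) i  ≈⟨ coeff-scale a (scale b p) i ⟩
    a * coeff (scale b p) i        ≈⟨ *-congˡ (coeff-scale b p i) ⟩
    a * (b * coeff p i)            ≈⟨ *-assoc _ _ _ ⟨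
    a * b * coeff p i              ≈⟨ coeff-scale (a * b) p i ⟨
    coeff (scale (a * b) p) i      ∎
    where open ≈-Reasoning

  scale-comm : ∀ a b p → scale a (scale b p) ≋ scale b (scale a p)
  scale-comm a b p = ≋-trans (scale-scale a b p)
    (≋-trans (scale-cong (*-comm a b) ≋-refl) (≋-sym (scale-scale b a p)))

  scale-identity : ∀ p → scale 1# p ≋ p
  scale-identity p = mk λ i → trans (coeff-scale 1# p i) (*-identityˡ _)

  scale-zero : ∀ p → scale 0# p ≋ []
  scale-zero p = mk λ i → trans (coeff-scale 0# p i) (zeroˡ _)

  *P-zeroˡ : ∀ {p} q → p ≋ [] → (p *P q) ≋ []
  *P-zeroˡ {[]}    q p≋[] = ≋-refl
  *P-zeroˡ {a ∷ p} q p≋[] = begin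
    scale a q +P (0# ∷ (p *P q))  ≈⟨ +P-cong (scale-cong (get p≋[] zero) ≋-refl)
                                           (0∷-≋[] (*P-zeroˡ q (∷≋[]⇒≋[] p≋[]))) ⟩
    scale 0# q +P []              ≈⟨ +P-identityʳ _ ⟩
    scale 0# q                    ≈⟨ scale-zero q ⟩
    []                            ∎
    where open ≋-Reasoning

  *P-zeroʳ : ∀ p → (p *P []) ≋ []
  *P-zeroʳ []      = ≋-refl
  *P-zeroʳ (a ∷ p) = 0∷-≋[] (*P-zeroʳ p)

  *P-congʳ : ∀ {p p′} q → p ≋ p′ → (p *P q) ≋ (p′ *P q)
  *P-congʳ {[]}    {p′}     q e = ≋-sym (*P-zeroˡ q (≋-sym e))
  *P-congʳ {a ∷ p} {[]}     q e = *P-zeroˡ q e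
  *P-congʳ {a ∷ p} {a′ ∷ p′} q e =
    +P-cong (scale-cong (get e zero) ≋-refl) (∷-cong refl (*P-congʳ q (∷-injectiveʳ e)))

  *P-congˡ : ∀ p {q q′} → q ≋ q′ → (p *P q) ≋ (p *P q′)
  *P-congˡ []      e = ≋-refl
  *P-congˡ (a ∷ p) e = +P-cong (scale-cong refl e) (∷-cong refl (*P-congˡ p e))

  *P-cong : ∀ {p p′ q q′} → p ≋ p′ → q ≋ q′ → (p *P q) ≋ (p′ *P q′)
  *P-cong {p} {p′} {q} e f = ≋-trans (*P-congʳ q e) (*P-congˡ p′ f)

  *P-distribʳ : ∀ p p′ q → ((p +P p′) *P q) ≋ ((p *P q) +P (p′ *P q))
  *P-distribʳ []      p′       q = ≋-refl
  *P-distribʳ (a ∷ p) []       q = ≋-sym (+P-identityʳ _)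
  *P-distribʳ (a ∷ p) (b ∷ p′) q = begin
    scale (a + b) q +P (0# ∷ ((p +P p′) *P q))
      ≈⟨ +P-cong (scale-distribʳ a b q) (∷-cong refl (*P-distribʳ p p′ q)) ⟩
    (scale a q +P scale b q) +P (0# ∷ ((p *P q) +P (p′ *P q)))
      ≈⟨ +P-congˡ (scale a q +P scale b q) (0∷-+P (p *P q) (p′ *P q)) ⟩
    (scale a q +P scale b q) +P ((0# ∷ (p *P q)) +P (0# ∷ (p′ *P q)))
      ≈⟨ +P-interchange (scale a q) (scale b q) (0# ∷ (p *P q)) (0# ∷ (p′ *P q)) ⟩
    (scale a q +P (0# ∷ (p *P q))) +P (scale b q +P (0# ∷ (p′ *P q)))
      ∎
    where open ≋-Reasoning

  *P-distribˡ : ∀ p q q′ → (p *P (q +P q′)) ≋ ((p *P q) +P (p *P q′))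
  *P-distribˡ []      q q′ = ≋-refl
  *P-distribˡ (a ∷ p) q q′ = begin
    scale a (q +P q′) +P (0# ∷ (p *P (q +P q′)))
      ≈⟨ +P-cong (scale-distribˡ a q q′) (∷-cong refl (*P-distribˡ p q q′)) ⟩
    (scale a q +P scale a q′) +P (0# ∷ ((p *P q) +P (p *P q′)))
      ≈⟨ +P-congˡ (scale a q +P scale a q′) (0∷-+P (p *P q) (p *P q′)) ⟩
    (scale a q +P scale a q′) +P ((0# ∷ (p *P q)) +P (0# ∷ (p *P q′)))
      ≈⟨ +P-interchange (scale a q) (scale a q′) (0# ∷ (p *P q)) (0# ∷ (p *P q′)) ⟩
    (scale a q +P (0# ∷ (p *P q))) +P (scale a q′ +P (0# ∷ (p *P q′)))
      ∎
    where open ≋-Reasoning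

  scale-*Pˡ : ∀ a p q → (scale a p *P q) ≋ scale a (p *P q)
  scale-*Pˡ a []      q = ≋-refl
  scale-*Pˡ a (b ∷ p) q = begin
    scale (a * b) q +P (0# ∷ (scale a p *P q))
      ≈⟨ +P-cong (≋-sym (scale-scale a b q)) (∷-cong (sym (zeroʳ a)) (scale-*Pˡ a p q)) ⟩
    scale a (scale b q) +P scale a (0# ∷ (p *P q))
      ≈⟨ scale-distribˡ a (scale b q) (0# ∷ (p *P q)) ⟨
    scale a (scale b q +P (0# ∷ (p *P q)))
      ∎
    where open ≋-Reasoning

  scale-*Pʳ : ∀ a p q → (p *P scale a q) ≋ scale a (p *P q)
  scale-*Pʳ a []      q = ≋-refl
  scale-*Pʳ a (b ∷ p) q = begin
    scale b (scale a q) +P (0# ∷ (p *P scale a q))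
      ≈⟨ +P-cong (scale-comm b a q) (∷-cong (sym (zeroʳ a)) (scale-*Pʳ a p q)) ⟩
    scale a (scale b q) +P scale a (0# ∷ (p *P q))
      ≈⟨ scale-distribˡ a (scale b q) (0# ∷ (p *P q)) ⟨
    scale a (scale b q +P (0# ∷ (p *P q)))
      ∎
    where open ≋-Reasoning

  0∷-*Pʳ : ∀ p q → (p *P (0# ∷ q)) ≋ (0# ∷ (p *P q))
  0∷-*Pʳ []      q = ≋-sym 0∷[]≋[]
  0∷-*Pʳ (a ∷ p) q = begin
    ((a * 0#) ∷ scale a q) +P (0# ∷ (p *P (0# ∷ q)))
      ≈⟨ +P-cong (∷-cong (zeroʳ a) ≋-refl) (∷-cong refl (0∷-*Pʳ p q)) ⟩
    (0# ∷ scale a q) +P (0# ∷ (0# ∷ (p *P q)))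
      ≈⟨ 0∷-+P (scale a q) (0# ∷ (p *P q)) ⟨
    0# ∷ (scale a q +P (0# ∷ (p *P q)))
      ∎
    where open ≋-Reasoning

  *P-identityˡ : ∀ p → (oneP *P p) ≋ p
  *P-identityˡ p = ≋-trans (+P-cong (scale-identity p) 0∷[]≋[]) (+P-identityʳ p)

  *P-identityʳ : ∀ p → (p *P oneP) ≋ p
  *P-identityʳ []      = ≋-refl
  *P-identityʳ (a ∷ p) = begin
    ((a * 1#) ∷ []) +P (0# ∷ (p *P oneP))
      ≈⟨ +P-cong (∷-cong (*-identityʳ a) ≋-refl) (∷-cong refl (*P-identityʳ p)) ⟩
    (a ∷ []) +P (0# ∷ p)
      ≈⟨ ∷-as-+P a p ⟨
    a ∷ p
      ∎
    where open ≋-Reasoning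

  constant-*P : ∀ a p → ((a ∷ []) *P p) ≋ scale a p
  constant-*P a p = ≋-trans (+P-congˡ (scale a p) 0∷[]≋[]) (+P-identityʳ _)

  *P-comm : ∀ p q → (p *P q) ≋ (q *P p)
  *P-comm []      q = ≋-sym (*P-zeroʳ q)
  *P-comm (a ∷ p) q = begin
    scale a q +P (0# ∷ (p *P q))
      ≈⟨ +P-cong (≋-sym (≋-trans (scale-*Pʳ a q oneP) (scale-cong refl (*P-identityʳ q))))
                 (∷-cong refl (*P-comm p q)) ⟩
    (q *P scale a oneP) +P (0# ∷ (q *P p))
      ≈⟨ +P-cong (*P-congˡ q (∷-cong (*-identityʳ a) ≋-refl)) (≋-sym (0∷-*Pʳ q p)) ⟩
    (q *P (a ∷ [])) +P (q *P (0# ∷ p))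
      ≈⟨ *P-distribˡ q (a ∷ []) (0# ∷ p) ⟨
    q *P ((a ∷ []) +P (0# ∷ p))
      ≈⟨ *P-congˡ q (∷-as-+P a p) ⟨
    q *P (a ∷ p)
      ∎
    where open ≋-Reasoning

  *P-assoc : ∀ p q r → ((p *P q) *P r) ≋ (p *P (q *P r))
  *P-assoc []      q r = ≋-refl
  *P-assoc (a ∷ p) q r = begin
    (scale a q +P (0# ∷ (p *P q))) *P r
      ≈⟨ *P-distribʳ (scale a q) (0# ∷ (p *P q)) r ⟩
    (scale a q *P r) +P ((0# ∷ (p *P q)) *P r)
      ≈⟨ +P-cong (scale-*Pˡ a q r) (+P-cong (scale-zero r) ≋-refl) ⟩
    scale a (q *P r) +P (0# ∷ ((p *P q) *P r))
      ≈⟨ +P-congˡ (scale a (q *P r)) (∷-cong refl (*P-assoc p q r)) ⟩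
    scale a (q *P r) +P (0# ∷ (p *P (q *P r)))
      ∎
    where open ≋-Reasoning

  *P-isCommutativeMonoid : IsCommutativeMonoid _≋_ _*P_ oneP
  *P-isCommutativeMonoid = record
    { isMonoid = record
      { isSemigroup = record
        { isMagma = record { isEquivalence = ≋-isEquivalence ; ∙-cong = *P-cong }
        ; assoc = *P-assoc }
      ; identity = *P-identityˡ , *P-identityʳ }
    ; comm = *P-comm }

  prodP-↭ : ∀ {ps qs} → ps ↭ qs → prodP ps ≋ prodP qs
  prodP-↭ ps↭qs = foldr-commMonoid ≋-setoid *P-isCommutativeMonoid (↭⇒↭ₛ′ ≋-isEquivalence ps↭qs)

  prodP-++ : ∀ ps qs → prodP (ps ++ qs) ≋ (prodP ps *P prodP qs)
  prodP-++ []       qs = ≋-sym (*P-identityˡ (prodP qs))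
  prodP-++ (p ∷ ps) qs =
    ≋-trans (*P-congˡ p (prodP-++ ps qs)) (≋-sym (*P-assoc p (prodP ps) (prodP qs)))

  prodP-cartesianProductWith : ∀ {A B C : Set} (g : C → Pol) (f : A → B → C) xs ys →
                               prodP (map g (cartesianProductWith f xs ys))
                                 ≋ prodP (map (λ x → prodP (map (g ∘ f x) ys)) xs)
  prodP-cartesianProductWith g f []       ys = ≋-refl
  prodP-cartesianProductWith g f (x ∷ xs) ys = begin
    prodP (map g (map (f x) ys ++ cartesianProductWith f xs ys))
      ≡⟨ ≡.cong prodP (List.map-++ g (map (f x) ys) _) ⟩
    prodP (map g (map (f x) ys) ++ map g (cartesianProductWith f xs ys))
      ≈⟨ prodP-++ (map g (map (f x) ys)) _ ⟩
    prodP (map g (map (f x) ys)) *P prodP (map g (cartesianProductWith f xs ys))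
      ≈⟨ *P-cong (≋-reflexive (≡.cong prodP (≡.sym (List.map-∘ ys)))) (prodP-cartesianProductWith g f xs ys) ⟩
    prodP (map (g ∘ f x) ys) *P prodP (map (λ x → prodP (map (g ∘ f x) ys)) xs)
      ∎
    where open ≋-Reasoning

  prodP-map-cong : ∀ {A : Set} {f g : A → Pol} → (∀ x → f x ≋ g x) →
                   ∀ xs → prodP (map f xs) ≋ prodP (map g xs)
  prodP-map-cong f≋g []       = ≋-refl
  prodP-map-cong f≋g (x ∷ xs) = *P-cong (f≋g x) (prodP-map-cong f≋g xs)

  prodP-map-scale : ∀ {A : Set} a (f : A → Pol) xs →
                    prodP (map (scale a ∘ f) xs) ≋ scale (pow a (length xs)) (prodP (map f xs))
  prodP-map-scale a f []       = ∷-cong (sym (*-identityʳ 1#)) ≋-refl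
  prodP-map-scale a f (x ∷ xs) = begin
    scale a (f x) *P prodP (map (scale a ∘ f) xs)
      ≈⟨ *P-congˡ (scale a (f x)) (prodP-map-scale a f xs) ⟩
    scale a (f x) *P scale (pow a (length xs)) (prodP (map f xs))
      ≈⟨ scale-*Pˡ a (f x) _ ⟩
    scale a (f x *P scale (pow a (length xs)) (prodP (map f xs)))
      ≈⟨ scale-cong refl (scale-*Pʳ _ (f x) _) ⟩
    scale a (scale (pow a (length xs)) (f x *P prodP (map f xs)))
      ≈⟨ scale-scale a _ _ ⟩
    scale (pow a (length (x ∷ xs))) (prodP (map f (x ∷ xs)))
      ∎
    where open ≋-Reasoning

  compose-+P : ∀ p r q → compose (p +P r) q ≋ (compose p q +P compose r q)
  compose-+P []      r       q = ≋-refl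
  compose-+P (a ∷ p) []      q = ≋-sym (+P-identityʳ _)
  compose-+P (a ∷ p) (b ∷ r) q = begin
    ((a + b) ∷ []) +P (q *P compose (p +P r) q)
      ≈⟨ +P-congˡ ((a + b) ∷ []) (*P-congˡ q (compose-+P p r q)) ⟩
    ((a + b) ∷ []) +P (q *P (compose p q +P compose r q))
      ≈⟨ +P-congˡ ((a + b) ∷ []) (*P-distribˡ q (compose p q) (compose r q)) ⟩
    ((a ∷ []) +P (b ∷ [])) +P ((q *P compose p q) +P (q *P compose r q))
      ≈⟨ +P-interchange (a ∷ []) (b ∷ []) (q *P compose p q) (q *P compose r q) ⟩
    ((a ∷ []) +P (q *P compose p q)) +P ((b ∷ []) +P (q *P compose r q))
      ∎
    where open ≋-Reasoning

  compose-scale : ∀ a p q → compose (scale a p) q ≋ scale a (compose p q)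
  compose-scale a []      q = ≋-refl
  compose-scale a (b ∷ p) q = begin
    ((a * b) ∷ []) +P (q *P compose (scale a p) q)
      ≈⟨ +P-congˡ ((a * b) ∷ []) (*P-congˡ q (compose-scale a p q)) ⟩
    ((a * b) ∷ []) +P (q *P scale a (compose p q))
      ≈⟨ +P-congˡ ((a * b) ∷ []) (scale-*Pʳ a q (compose p q)) ⟩
    scale a (b ∷ []) +P scale a (q *P compose p q)
      ≈⟨ scale-distribˡ a (b ∷ []) (q *P compose p q) ⟨
    scale a ((b ∷ []) +P (q *P compose p q))
      ∎
    where open ≋-Reasoning

  compose-*P : ∀ p r q → compose (p *P r) q ≋ (compose p q *P compose r q)
  compose-*P []      r q = ≋-refl
  compose-*P (a ∷ p) r q = begin
    compose (scale a r +P (0# ∷ (p *P r))) q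
      ≈⟨ compose-+P (scale a r) (0# ∷ (p *P r)) q ⟩
    compose (scale a r) q +P compose (0# ∷ (p *P r)) q
      ≈⟨ +P-cong (compose-scale a r q) (+P-cong 0∷[]≋[] (*P-congˡ q (compose-*P p r q))) ⟩
    scale a (compose r q) +P (q *P (compose p q *P compose r q))
      ≈⟨ +P-cong (≋-sym (constant-*P a (compose r q)))
                 (≋-sym (*P-assoc q (compose p q) (compose r q))) ⟩
    ((a ∷ []) *P compose r q) +P ((q *P compose p q) *P compose r q)
      ≈⟨ *P-distribʳ (a ∷ []) (q *P compose p q) (compose r q) ⟨
    ((a ∷ []) +P (q *P compose p q)) *P compose r q
      ∎
    where open ≋-Reasoning

  compose-prodP : ∀ ps q → compose (prodP ps) q ≋ prodP (map (λ p → compose p q) ps)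
  compose-prodP []       q = +P-congˡ oneP (*P-zeroʳ q)
  compose-prodP (p ∷ ps) q =
    ≋-trans (compose-*P p (prodP ps) q) (*P-congˡ (compose p q) (compose-prodP ps q))

  compose-linear : ∀ a q → compose (linear a) q ≋ (((- a) ∷ []) +P q)
  compose-linear a q = +P-congˡ ((- a) ∷ []) (begin
    q *P (oneP +P (q *P []))  ≈⟨ *P-congˡ q (+P-congˡ oneP (*P-zeroʳ q)) ⟩
    q *P oneP                 ≈⟨ *P-identityʳ q ⟩
    q                         ∎)
    where open ≋-Reasoning

  compose-linear-cong : ∀ {a b} q → a ≈ b → compose (linear a) q ≋ compose (linear b) q
  compose-linear-cong {a} {b} q a≈b = ≋-trans (compose-linear a q)
    (≋-trans (+P-cong {q = q} (∷-cong (-‿cong a≈b) ≋-refl) ≋-refl) (≋-sym (compose-linear b q)))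

  eval : Pol → Carrier → Carrier
  eval []      y = 0#
  eval (a ∷ p) y = a + y * eval p y

  eval-+P : ∀ p q y → eval (p +P q) y ≈ eval p y + eval q y
  eval-+P []      q       y = sym (+-identityˡ _)
  eval-+P (a ∷ p) []      y = sym (+-identityʳ _)
  eval-+P (a ∷ p) (b ∷ q) y = begin
    (a + b) + y * eval (p +P q) y             ≈⟨ +-congˡ (*-congˡ (eval-+P p q y)) ⟩
    (a + b) + y * (eval p y + eval q y)       ≈⟨ +-congˡ (distribˡ _ _ _) ⟩
    (a + b) + (y * eval p y + y * eval q y)   ≈⟨ +-interchange a b _ _ ⟩
    (a + y * eval p y) + (b + y * eval q y)   ∎
    where
    open ≈-Reasoning
    open CommSemigroupProperties +-commutativeSemigroup using () renaming (interchange to +-interchange)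

  eval-scale : ∀ a p y → eval (scale a p) y ≈ a * eval p y
  eval-scale a []      y = sym (zeroʳ a)
  eval-scale a (b ∷ p) y = begin
    a * b + y * eval (scale a p) y  ≈⟨ +-congˡ (*-congˡ (eval-scale a p y)) ⟩
    a * b + y * (a * eval p y)      ≈⟨ +-congˡ (x∙yz≈y∙xz y a _) ⟩
    a * b + a * (y * eval p y)      ≈⟨ distribˡ _ _ _ ⟨
    a * (b + y * eval p y)          ∎
    where open ≈-Reasoning

  eval-≋[] : ∀ {p} y → p ≋ [] → eval p y ≈ 0#
  eval-≋[] {[]}    y p≋[] = refl
  eval-≋[] {a ∷ p} y p≋[] = begin
    a + y * eval p y  ≈⟨ +-cong (get p≋[] zero) (*-congˡ (eval-≋[] y (∷≋[]⇒≋[] p≋[]))) ⟩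
    0# + y * 0#       ≈⟨ trans (+-identityˡ _) (zeroʳ y) ⟩
    0#                ∎
    where open ≈-Reasoning

  eval-cong : ∀ {p q} y → p ≋ q → eval p y ≈ eval q y
  eval-cong {[]}    y e = sym (eval-≋[] y (≋-sym e))
  eval-cong {a ∷ p} {[]}    y e = eval-≋[] y e
  eval-cong {a ∷ p} {b ∷ q} y e = +-cong (get e zero) (*-congˡ (eval-cong y (∷-injectiveʳ e)))

  eval-*P : ∀ p q y → eval (p *P q) y ≈ eval p y * eval q y
  eval-*P []      q y = sym (zeroˡ _)
  eval-*P (a ∷ p) q y = begin
    eval (scale a q +P (0# ∷ (p *P q))) y
      ≈⟨ eval-+P (scale a q) (0# ∷ (p *P q)) y ⟩
    eval (scale a q) y + (0# + y * eval (p *P q) y)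
      ≈⟨ +-cong (eval-scale a q y) (trans (+-identityˡ _) (*-congˡ (eval-*P p q y))) ⟩
    a * eval q y + y * (eval p y * eval q y)
      ≈⟨ +-congˡ (*-assoc _ _ _) ⟨
    a * eval q y + y * eval p y * eval q y
      ≈⟨ distribʳ _ _ _ ⟨
    (a + y * eval p y) * eval q y
      ∎
    where open ≈-Reasoning

  eval-linear-root : ∀ y → eval (linear y) y ≈ 0#
  eval-linear-root y = begin
    - y + y * (1# + y * 0#)  ≈⟨ +-congˡ (*-congˡ (trans (+-congˡ (zeroʳ y)) (+-identityʳ 1#))) ⟩
    - y + y * 1#             ≈⟨ +-congˡ (*-identityʳ y) ⟩
    - y + y                  ≈⟨ -‿inverseˡ y ⟩
    0#                       ∎
    where open ≈-Reasoning

  -- dilate ω p = p(ω x)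
  dilate : Carrier → Pol → Pol
  dilate ω []      = []
  dilate ω (a ∷ p) = a ∷ scale ω (dilate ω p)

  coeff-dilate : ∀ ω p i → coeff (dilate ω p) i ≈ pow ω i * coeff p i
  coeff-dilate ω []      i       = sym (zeroʳ _)
  coeff-dilate ω (a ∷ p) zero    = sym (*-identityˡ a)
  coeff-dilate ω (a ∷ p) (suc i) = begin
    coeff (scale ω (dilate ω p)) i  ≈⟨ coeff-scale ω (dilate ω p) i ⟩
    ω * coeff (dilate ω p) i        ≈⟨ *-congˡ (coeff-dilate ω p i) ⟩
    ω * (pow ω i * coeff p i)       ≈⟨ *-assoc _ _ _ ⟨
    pow ω (suc i) * coeff p i       ∎
    where open ≈-Reasoning

  dilate-cong : ∀ ω {p q} → p ≋ q → dilate ω p ≋ dilate ω q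
  dilate-cong ω {p} {q} (mk e) = mk λ i →
    trans (coeff-dilate ω p i) (trans (*-congˡ (e i)) (sym (coeff-dilate ω q i)))

  dilate-+P : ∀ ω p q → dilate ω (p +P q) ≋ (dilate ω p +P dilate ω q)
  dilate-+P ω p q = mk λ i → begin
    coeff (dilate ω (p +P q)) i                  ≈⟨ coeff-dilate ω (p +P q) i ⟩
    pow ω i * coeff (p +P q) i                   ≈⟨ *-congˡ (coeff-+P p q i) ⟩
    pow ω i * (coeff p i + coeff q i)            ≈⟨ distribˡ _ _ _ ⟩
    pow ω i * coeff p i + pow ω i * coeff q i    ≈⟨ +-cong (coeff-dilate ω p i) (coeff-dilate ω q i) ⟨
    coeff (dilate ω p) i + coeff (dilate ω q) i  ≈⟨ coeff-+P (dilate ω p) (dilate ω q) i ⟨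
    coeff (dilate ω p +P dilate ω q) i           ∎
    where open ≈-Reasoning

  dilate-scale : ∀ ω a p → dilate ω (scale a p) ≋ scale a (dilate ω p)
  dilate-scale ω a p = mk λ i → begin
    coeff (dilate ω (scale a p)) i  ≈⟨ coeff-dilate ω (scale a p) i ⟩
    pow ω i * coeff (scale a p) i   ≈⟨ *-congˡ (coeff-scale a p i) ⟩
    pow ω i * (a * coeff p i)       ≈⟨ x∙yz≈y∙xz _ _ _ ⟩
    a * (pow ω i * coeff p i)       ≈⟨ *-congˡ (coeff-dilate ω p i) ⟨
    a * coeff (dilate ω p) i        ≈⟨ coeff-scale a (dilate ω p) i ⟨
    coeff (scale a (dilate ω p)) i  ∎
    where open ≈-Reasoning

  dilate-*P : ∀ ω p q → dilate ω (p *P q) ≋ (dilate ω p *P dilate ω q)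
  dilate-*P ω []      q = ≋-refl
  dilate-*P ω (a ∷ p) q = begin
    dilate ω (scale a q +P (0# ∷ (p *P q)))
      ≈⟨ dilate-+P ω (scale a q) (0# ∷ (p *P q)) ⟩
    dilate ω (scale a q) +P (0# ∷ scale ω (dilate ω (p *P q)))
      ≈⟨ +P-cong (dilate-scale ω a q) (∷-cong refl (scale-cong refl (dilate-*P ω p q))) ⟩
    scale a (dilate ω q) +P (0# ∷ scale ω (dilate ω p *P dilate ω q))
      ≈⟨ +P-congˡ (scale a (dilate ω q)) (∷-cong refl (≋-sym (scale-*Pˡ ω (dilate ω p) (dilate ω q)))) ⟩
    scale a (dilate ω q) +P (0# ∷ (scale ω (dilate ω p) *P dilate ω q))
      ∎
    where open ≋-Reasoning

  dilate-prodP : ∀ ω ps → dilate ω (prodP ps) ≋ prodP (map (dilate ω) ps)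
  dilate-prodP ω []       = ∷-cong refl ≋-refl
  dilate-prodP ω (p ∷ ps) =
    ≋-trans (dilate-*P ω p (prodP ps)) (*P-congˡ (dilate ω p) (dilate-prodP ω ps))

  prodP-rotate : ∀ (f : ℕ → Pol) n → f n ≋ f 0 →
                 prodP (map (f ∘ suc) (upTo n)) ≋ prodP (map f (upTo n))
  prodP-rotate f zero    _       = ≋-refl
  prodP-rotate f (suc n) fn≋f0 = begin
    prodP (map (f ∘ suc) (upTo (suc n)))
      ≡⟨ ≡.cong (prodP ∘ map (f ∘ suc)) (≡.sym (List.upTo-∷ʳ n)) ⟩
    prodP (map (f ∘ suc) (upTo n ∷ʳ n))
      ≡⟨ ≡.cong prodP (List.map-++ (f ∘ suc) (upTo n) [ n ]) ⟩
    prodP (map (f ∘ suc) (upTo n) ∷ʳ f (suc n))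
      ≈⟨ prodP-↭ (↭.∷↭∷ʳ (f (suc n)) (map (f ∘ suc) (upTo n))) ⟨
    prodP (f (suc n) ∷ map (f ∘ suc) (upTo n))
      ≈⟨ *P-congʳ _ fn≋f0 ⟩
    prodP (f 0 ∷ map (f ∘ suc) (upTo n))
      ≡⟨ ≡.cong (λ fs → prodP (f 0 ∷ fs))
                (≡.trans (List.map-upTo (f ∘ suc) n) (≡.sym (List.map-applyUpTo suc f n))) ⟩
    prodP (map f (upTo (suc n)))
      ∎
    where open ≋-Reasoning

  pow≡^ : ∀ x k → pow x k ≡ x ^ k
  pow≡^ x zero    = ≡.refl
  pow≡^ x (suc k) = ≡.cong (x *_) (pow≡^ x k)

  pow-+ : ∀ x a b → pow x (a ℕ.+ b) ≈ pow x a * pow x b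
  pow-+ x a b = begin
    pow x (a ℕ.+ b)    ≡⟨ pow≡^ x (a ℕ.+ b) ⟩
    x ^ (a ℕ.+ b)      ≈⟨ ^-homo-* x a b ⟩
    x ^ a * x ^ b      ≡⟨ ≡.cong₂ _*_ (pow≡^ x a) (pow≡^ x b) ⟨
    pow x a * pow x b  ∎
    where open ≈-Reasoning

  pow-* : ∀ x a b → pow x (a ℕ.* b) ≈ pow (pow x a) b
  pow-* x a b = begin
    pow x (a ℕ.* b)  ≡⟨ pow≡^ x (a ℕ.* b) ⟩
    x ^ (a ℕ.* b)    ≈⟨ ^-assocʳ x a b ⟨
    (x ^ a) ^ b      ≡⟨ ≡.cong (_^ b) (pow≡^ x a) ⟨
    pow x a ^ b      ≡⟨ pow≡^ (pow x a) b ⟨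
    pow (pow x a) b  ∎
    where open ≈-Reasoning

  coeff-xpow-≡ : ∀ m → coeff (xpow m) m ≈ 1#
  coeff-xpow-≡ zero    = refl
  coeff-xpow-≡ (suc m) = coeff-xpow-≡ m

  coeff-xpow-≢ : ∀ m i → i ≢ m → coeff (xpow m) i ≈ 0#
  coeff-xpow-≢ zero    zero    i≢m = ⊥-elim (i≢m ≡.refl)
  coeff-xpow-≢ zero    (suc i) i≢m = refl
  coeff-xpow-≢ (suc m) zero    i≢m = refl
  coeff-xpow-≢ (suc m) (suc i) i≢m = coeff-xpow-≢ m i (i≢m ∘ ≡.cong suc)

  eval-xpow : ∀ m y → eval (xpow m) y ≈ pow y m
  eval-xpow zero    y = trans (+-congˡ (zeroʳ y)) (+-identityʳ 1#)
  eval-xpow (suc m) y = trans (+-identityˡ _) (*-congˡ (eval-xpow m y))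

  linear-cong : ∀ {a b} → a ≈ b → linear a ≋ linear b
  linear-cong a≈b = ∷-cong (-‿cong a≈b) ≋-refl

  coeff-linear-*P : ∀ a q i → coeff (linear a *P q) (suc i) ≈ - a * coeff q (suc i) + coeff q i
  coeff-linear-*P a q i = begin
    coeff (scale (- a) q +P (0# ∷ (oneP *P q))) (suc i)
      ≈⟨ coeff-+P (scale (- a) q) (0# ∷ (oneP *P q)) (suc i) ⟩
    coeff (scale (- a) q) (suc i) + coeff (oneP *P q) i
      ≈⟨ +-cong (coeff-scale (- a) q (suc i)) (get (*P-identityˡ q) i) ⟩
    - a * coeff q (suc i) + coeff q i
      ∎
    where open ≈-Reasoning

  coeff-prodLinear->length : ∀ as i → length as < i → coeff (prodP (map linear as)) i ≈ 0#
  coeff-prodLinear->length []       (suc i) _           = refl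
  coeff-prodLinear->length (a ∷ as) (suc i) (s≤s len<i) = begin
    coeff (linear a *P P) (suc i)
      ≈⟨ coeff-linear-*P a P i ⟩
    - a * coeff P (suc i) + coeff P i
      ≈⟨ +-cong (*-congˡ (coeff-prodLinear->length as (suc i) (ℕ.m<n⇒m<1+n len<i)))
                (coeff-prodLinear->length as i len<i) ⟩
    - a * 0# + 0#
      ≈⟨ trans (+-identityʳ _) (zeroʳ _) ⟩
    0#
      ∎
    where
    open ≈-Reasoning
    P = prodP (map linear as)

  coeff-prodLinear-length : ∀ as → coeff (prodP (map linear as)) (length as) ≈ 1#
  coeff-prodLinear-length []       = refl
  coeff-prodLinear-length (a ∷ as) = begin
    coeff (linear a *P P) (suc (length as))
      ≈⟨ coeff-linear-*P a P (length as) ⟩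
    - a * coeff P (suc (length as)) + coeff P (length as)
      ≈⟨ +-cong (*-congˡ (coeff-prodLinear->length as _ ℕ.≤-refl)) (coeff-prodLinear-length as) ⟩
    - a * 0# + 1#
      ≈⟨ trans (+-congʳ (zeroʳ _)) (+-identityˡ _) ⟩
    1#
      ∎
    where
    open ≈-Reasoning
    P = prodP (map linear as)

module RootsOfUnity {c ℓ : Level} (R : CommutativeRing c ℓ) (domain : Poly.IsDomain R) where

  open CommutativeRing R hiding (zero)
  open Poly R
  open PolynomialArithmetic R
  open RingProperties ring using (-1*x≈-x; -‿distribʳ-*; +-inverseˡ-unique; x∙y⁻¹≈ε⇒x≈y)
  open CommSemigroupProperties *-commutativeSemigroup using (x∙yz≈y∙xz)

  x*y≈y⇒x≈1⊎y≈0 : ∀ x y → x * y ≈ y → x ≈ 1# ⊎ y ≈ 0#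
  x*y≈y⇒x≈1⊎y≈0 x y xy≈y with proj₂ domain (x + - 1#) y (begin
    (x + - 1#) * y    ≈⟨ distribʳ _ _ _ ⟩
    x * y + - 1# * y  ≈⟨ +-cong xy≈y (-1*x≈-x y) ⟩
    y + - y           ≈⟨ -‿inverseʳ y ⟩
    0#                ∎)
    where open ≈-Reasoning
  ... | inj₁ x-1≈0 = inj₁ (x∙y⁻¹≈ε⇒x≈y x 1# x-1≈0)
  ... | inj₂ y≈0   = inj₂ y≈0

  -- For a primitive m-th root of unity ω, the roots y ωᵏ (k < m) of ∏ (x - y ωᵏ) are permuted
  -- by x ↦ ω x, so the product is invariant under dilation by ω; comparing coefficients,
  -- every coefficient strictly between 0 and m vanishes.
  module Factorisation {m′ : ℕ} {ω : Carrier} (ω-primitive : IsPrimitiveRoot (suc m′) ω) (y : Carrier) where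

    m : ℕ
    m = suc m′

    factor : ℕ → Pol
    factor k = linear (y * pow ω k)

    P : Pol
    P = prodP (map factor (upTo m))

    roots : List Carrier
    roots = map (λ k → y * pow ω k) (upTo m)

    P≡prodLinear : P ≡ prodP (map linear roots)
    P≡prodLinear = ≡.cong prodP (List.map-∘ (upTo m))

    length-roots : length roots ≡ m
    length-roots = ≡.trans (List.length-map _ (upTo m)) (List.length-upTo m)

    factor-period : factor m ≋ factor 0
    factor-period = linear-cong (*-congˡ (proj₁ ω-primitive))

    dilate-factor : ∀ k → dilate ω (factor (suc k)) ≋ scale ω (factor k)
    dilate-factor k = ∷-cong (trans (-‿cong (x∙yz≈y∙xz y ω (pow ω k))) (-‿distribʳ-* ω _))
                             (∷-cong refl ≋-refl)

    dilate-P : dilate ω P ≋ P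
    dilate-P = begin
      dilate ω P                                         ≈⟨ dilate-cong ω (prodP-rotate factor m factor-period) ⟨
      dilate ω (prodP (map (factor ∘ suc) (upTo m)))     ≈⟨ dilate-prodP ω (map (factor ∘ suc) (upTo m)) ⟩
      prodP (map (dilate ω) (map (factor ∘ suc) (upTo m))) ≡⟨ ≡.cong prodP (List.map-∘ (upTo m)) ⟨
      prodP (map (dilate ω ∘ factor ∘ suc) (upTo m))     ≈⟨ prodP-map-cong dilate-factor (upTo m) ⟩
      prodP (map (scale ω ∘ factor) (upTo m))            ≈⟨ prodP-map-scale ω factor (upTo m) ⟩
      scale (pow ω (length (upTo m))) P                  ≈⟨ scale-cong ωᵐ≈1 ≋-refl ⟩
      scale 1# P                                         ≈⟨ scale-identity P ⟩
      P                                                  ∎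
      where
      open ≋-Reasoning
      ωᵐ≈1 : pow ω (length (upTo m)) ≈ 1#
      ωᵐ≈1 = trans (reflexive (≡.cong (pow ω) (List.length-upTo m))) (proj₁ ω-primitive)

    coeff-P-middle : ∀ i → 1 ℕ.≤ i → i < m → coeff P i ≈ 0#
    coeff-P-middle i 1≤i i<m with x*y≈y⇒x≈1⊎y≈0 (pow ω i) (coeff P i)
                                    (trans (sym (coeff-dilate ω P i)) (get dilate-P i))
    ... | inj₁ ωⁱ≈1 = ⊥-elim (proj₂ ω-primitive i 1≤i i<m ωⁱ≈1)
    ... | inj₂ cᵢ≈0 = cᵢ≈0

    coeff-P-length : coeff P m ≈ 1#
    coeff-P-length = begin
      coeff P m                                        ≡⟨ ≡.cong₂ coeff P≡prodLinear (≡.sym length-roots) ⟩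
      coeff (prodP (map linear roots)) (length roots)  ≈⟨ coeff-prodLinear-length roots ⟩
      1#                                               ∎
      where open ≈-Reasoning

    coeff-P->length : ∀ i → m < i → coeff P i ≈ 0#
    coeff-P->length i m<i = begin
      coeff P i                           ≡⟨ ≡.cong (λ p → coeff p i) P≡prodLinear ⟩
      coeff (prodP (map linear roots)) i  ≈⟨ coeff-prodLinear->length roots i length<i ⟩
      0#                                  ∎
      where
      open ≈-Reasoning
      length<i = ≡.subst (_< i) (≡.sym length-roots) m<i

    P≋c₀+xᵐ : P ≋ ((coeff P 0 ∷ []) +P xpow m)
    P≋c₀+xᵐ = mk λ { zero → sym (+-identityʳ _) ; (suc i) → coeff-suc i }
      where
      coeff-suc : ∀ i → coeff P (suc i) ≈ coeff (xpow m′) i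
      coeff-suc i with ℕ.<-cmp i m′
      ... | tri< i<m′ _ _    = trans (coeff-P-middle (suc i) (s≤s z≤n) (s≤s i<m′))
                                     (sym (coeff-xpow-≢ m′ i (ℕ.<⇒≢ i<m′)))
      ... | tri≈ _ ≡.refl _ = trans coeff-P-length (sym (coeff-xpow-≡ m′))
      ... | tri> _ _ m′<i    = trans (coeff-P->length (suc i) (s≤s m′<i))
                                     (sym (coeff-xpow-≢ m′ i (ℕ.>⇒≢ m′<i)))

    y-root : eval P y ≈ 0#
    y-root = begin
      eval (factor 0 *P Q) y        ≈⟨ eval-*P (factor 0) Q y ⟩
      eval (factor 0) y * eval Q y  ≈⟨ *-congʳ y-root-of-factor₀ ⟩
      0# * eval Q y                 ≈⟨ zeroˡ _ ⟩
      0#                            ∎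
      where
      open ≈-Reasoning
      Q = prodP (map factor (applyUpTo suc m′))
      y-root-of-factor₀ : eval (factor 0) y ≈ 0#
      y-root-of-factor₀ = trans (eval-cong y (linear-cong (*-identityʳ y))) (eval-linear-root y)

    c₀≈-yᵐ : coeff P 0 ≈ - pow y m
    c₀≈-yᵐ = +-inverseˡ-unique _ _ (begin
      coeff P 0 + pow y m
        ≈⟨ +-cong (trans (+-congˡ (zeroʳ y)) (+-identityʳ _)) (eval-xpow m y) ⟨
      eval (coeff P 0 ∷ []) y + eval (xpow m) y
        ≈⟨ eval-+P (coeff P 0 ∷ []) (xpow m) y ⟨
      eval ((coeff P 0 ∷ []) +P xpow m) y
        ≈⟨ eval-cong y P≋c₀+xᵐ ⟨
      eval P y
        ≈⟨ y-root ⟩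
      0#
        ∎)
      where open ≈-Reasoning

    xᵐ-yᵐ≋∏x-yωᵏ : compose (linear (pow y m)) (xpow m) ≋ P
    xᵐ-yᵐ≋∏x-yωᵏ = begin
      compose (linear (pow y m)) (xpow m)  ≈⟨ compose-linear (pow y m) (xpow m) ⟩
      ((- pow y m) ∷ []) +P xpow m         ≈⟨ +P-cong {q = xpow m} (∷-cong c₀≈-yᵐ ≋-refl) ≋-refl ⟨
      (coeff P 0 ∷ []) +P xpow m           ≈⟨ P≋c₀+xᵐ ⟨
      P                                    ∎
      where open ≋-Reasoning

  open Factorisation public using (xᵐ-yᵐ≋∏x-yωᵏ)

  ^-primitive : ∀ {κ m ζ} → 1 ℕ.≤ κ → IsPrimitiveRoot (κ ℕ.* m) ζ → IsPrimitiveRoot m (pow ζ κ)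
  ^-primitive {κ} {m} {ζ} 1≤κ (ζ^κm≈1 , ζ-primitive) =
    trans (sym (pow-* ζ κ m)) ζ^κm≈1 ,
    λ d 1≤d d<m ζ^κ^d≈1 → ζ-primitive (κ ℕ.* d) (ℕ.*-mono-≤ 1≤κ 1≤d)
      (ℕ.*-monoʳ-< κ {{ℕ.>-nonZero 1≤κ}} d<m) (trans (pow-* ζ κ d) ζ^κ^d≈1)

  -- xᵐ − ζᵐʲ = ∏_{k<m} (x − ζ^{j+κk}), where xᵐ − a is written compose (linear a) (xpow m)
  xᵐ-ζᵐʲ≋∏x-ζʲ⁺ᵏᵏ : ∀ {κ m′ ζ} → 1 ℕ.≤ κ → IsPrimitiveRoot (κ ℕ.* suc m′) ζ → ∀ j →
                    compose (linear (pow (pow ζ (suc m′)) j)) (xpow (suc m′))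
                      ≋ prodP (map (λ k → linear (pow ζ (j ℕ.+ κ ℕ.* k))) (upTo (suc m′)))
  xᵐ-ζᵐʲ≋∏x-ζʲ⁺ᵏᵏ {κ} {m′} {ζ} 1≤κ ζ-primitive j = begin
    compose (linear (pow (pow ζ m) j)) (xpow m)
      ≈⟨ compose-linear-cong (xpow m) ζᵐʲ≈ζʲᵐ ⟩
    compose (linear (pow (pow ζ j) m)) (xpow m)
      ≈⟨ xᵐ-yᵐ≋∏x-yωᵏ (^-primitive 1≤κ ζ-primitive) (pow ζ j) ⟩
    prodP (map (λ k → linear (pow ζ j * pow (pow ζ κ) k)) (upTo m))
      ≈⟨ prodP-map-cong (λ k → linear-cong (ζʲζᵏᵏ≈ζʲ⁺ᵏᵏ k)) (upTo m) ⟩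
    prodP (map (λ k → linear (pow ζ (j ℕ.+ κ ℕ.* k))) (upTo m)) ∎
    where
    open ≋-Reasoning
    m = suc m′
    ζᵐʲ≈ζʲᵐ : pow (pow ζ m) j ≈ pow (pow ζ j) m
    ζᵐʲ≈ζʲᵐ = trans (sym (pow-* ζ m j)) (trans (reflexive (≡.cong (pow ζ) (ℕ.*-comm m j))) (pow-* ζ j m))
    ζʲζᵏᵏ≈ζʲ⁺ᵏᵏ : ∀ k → pow ζ j * pow (pow ζ κ) k ≈ pow ζ (j ℕ.+ κ ℕ.* k)
    ζʲζᵏᵏ≈ζʲ⁺ᵏᵏ k = trans (*-congˡ (sym (pow-* ζ κ k))) (sym (pow-+ ζ j (κ ℕ.* k)))

module Arithmetic where

  open import Data.Nat
  open import Data.Nat.Properties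
  open import Data.Nat.Divisibility
  open import Data.Nat.Coprimality using (Coprime)
  open import Data.Nat.Primality
  open import Data.Nat.Primality.Factorisation using (factorise)
  open import Data.Nat.DivMod using (_%_; _/_; m≡m%n+[m/n]*n; m%n<n; m<n*o⇒m/o<n; m<n⇒m%n≡m; [m+kn]%n≡m%n; %-congˡ)
  open import Data.Nat.Induction using (<-rec)
  open import Data.Nat.ListAction using (product)
  open import Data.List.Membership.Propositional using (_∈_; _∉_)
  open import Data.List.Membership.Propositional.Properties
    using (∈-map⁺; ∈-map⁻; ∈-upTo⁺; ∈-upTo⁻; ∈-cartesianProductWith⁻)
  open import Data.List.Relation.Unary.Any using (here; there)
  open import Data.List.Relation.Unary.All as All using (All; []; _∷_)
  open import Data.List.Relation.Unary.AllPairs using ([]; _∷_)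
  open import Data.List.Relation.Unary.Unique.Propositional using (Unique)
  import Data.List.Relation.Unary.Unique.Propositional.Properties as Unique
  open import Data.Product using (∃; ∃₂)
  open import Relation.Nullary using (yes; no)
  open import Relation.Unary using (Pred; Decidable)
  open import Data.List.Relation.Binary.BagAndSetEquality using (∼bag⇒↭)
  open import Data.List.Membership.Setoid.Properties using (unique⇒irrelevant)
  open import Function.Bundles using (mk↔ₛ′)
  open import Level using (0ℓ)
  open ≡ using (refl; sym; trans; cong; subst)

  prime⇒>1 : ∀ {p} → Prime p → 1 < p
  prime⇒>1 {p} p-prime = nonTrivial⇒n>1 p {{prime⇒nonTrivial p-prime}}

  ∃prime∣ : ∀ d → 1 < d → ∃ λ p → Prime p × p ∣ d
  ∃prime∣ (suc zero)      (s≤s ())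
  ∃prime∣ d@(suc (suc _)) _ with factorise d
  ... | record { factors = [] ; isFactorisation = () }
  ... | record { factors = p ∷ ps ; isFactorisation = d≡∏ ; factorsPrime = p-prime ∷ _ } =
    p , p-prime , subst (p ∣_) (sym d≡∏) (m∣m*n _)

  prime∣prime⇒≡ : ∀ {p q} → Prime p → Prime q → p ∣ q → p ≡ q
  prime∣prime⇒≡ p-prime q-prime p∣q with prime⇒irreducible q-prime p∣q
  ... | inj₁ refl = ⊥-elim (<-irrefl refl (prime⇒>1 p-prime))
  ... | inj₂ p≡q  = p≡q

  prime∣^⇒∣ : ∀ {p} m e → Prime p → p ∣ m ^ e → p ∣ m
  prime∣^⇒∣ m zero    p-prime p∣1 = ⊥-elim (<-irrefl (sym (∣1⇒≡1 p∣1)) (prime⇒>1 p-prime))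
  prime∣^⇒∣ m (suc e) p-prime p∣mᵉ⁺¹ with euclidsLemma m (m ^ e) p-prime p∣mᵉ⁺¹
  ... | inj₁ p∣m  = p∣m
  ... | inj₂ p∣mᵉ = prime∣^⇒∣ m e p-prime p∣mᵉ

  ^-monoʳ-∣ : ∀ m {a b} → a ≤ b → m ^ a ∣ m ^ b
  ^-monoʳ-∣ m {a} {b} a≤b = divides (m ^ (b ∸ a)) (begin
    m ^ b                ≡⟨ cong (m ^_) (m+[n∸m]≡n a≤b) ⟨
    m ^ (a + (b ∸ a))    ≡⟨ ^-distribˡ-+-* m a (b ∸ a) ⟩
    m ^ a * m ^ (b ∸ a)  ≡⟨ *-comm (m ^ a) _ ⟩
    m ^ (b ∸ a) * m ^ a  ∎)
    where open ≡.≡-Reasoning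

  n<m^n : ∀ {m} n → 1 < m → n < m ^ n
  n<m^n zero    1<m = s≤s z≤n
  n<m^n {m} (suc n) 1<m = begin-strict
    suc n          <⟨ s≤s (n<m^n n 1<m) ⟩
    suc (m ^ n)    ≤⟨ +-monoˡ-≤ (m ^ n) m^n≥1 ⟩
    m ^ n + m ^ n  ≡⟨ cong (m ^ n +_) (+-identityʳ (m ^ n)) ⟨
    2 * m ^ n      ≤⟨ *-monoˡ-≤ (m ^ n) 1<m ⟩
    m ^ suc n      ∎
    where
    open ≤-Reasoning
    m^n≥1 : 1 ≤ m ^ n
    m^n≥1 = m^n>0 m {{>-nonZero (<-trans z<s 1<m)}} n

  ^-injectiveʳ : ∀ {m b c} → 1 < m → m ^ b ≡ m ^ c → b ≡ c
  ^-injectiveʳ {m} {b} {c} 1<m mᵇ≡mᶜ with <-cmp b c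
  ... | tri< b<c _ _ = ⊥-elim (<-irrefl mᵇ≡mᶜ (^-monoʳ-< m 1<m b<c))
  ... | tri≈ _ b≡c _ = b≡c
  ... | tri> _ _ c<b = ⊥-elim (<-irrefl (sym mᵇ≡mᶜ) (^-monoʳ-< m 1<m c<b))

  ¬∣⇒≥1 : ∀ {p n} → ¬ p ∣ n → 1 ≤ n
  ¬∣⇒≥1 {p} {zero}  p∤0 = ⊥-elim (p∤0 (p ∣0))
  ¬∣⇒≥1 {p} {suc n} _   = s≤s z≤n

  prime∤⇒coprime-^ : ∀ {p n} v → Prime p → ¬ p ∣ n → Coprime (p ^ v) n
  prime∤⇒coprime-^ {p} {n} v p-prime p∤n {zero}            (_ , 0∣n)    =
    ⊥-elim (p∤n (subst (p ∣_) (sym (0∣⇒≡0 0∣n)) (p ∣0)))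
  prime∤⇒coprime-^ {p} {n} v p-prime p∤n {suc zero}        _            = refl
  prime∤⇒coprime-^ {p} {n} v p-prime p∤n {d@(suc (suc _))} (d∣pᵛ , d∣n)
    with ∃prime∣ d (s≤s (s≤s z≤n))
  ... | q , q-prime , q∣d = ⊥-elim (p∤n (subst (_∣ n) q≡p (∣-trans q∣d d∣n)))
    where
    q≡p : q ≡ p
    q≡p = prime∣prime⇒≡ q-prime p-prime (prime∣^⇒∣ p v q-prime (∣-trans q∣d d∣pᵛ))

  record Splitting (p n : ℕ) : Set where
    constructor splitting
    field
      exponent  : ℕ
      rest      : ℕ
      n≡pᵉ*rest : n ≡ p ^ exponent * rest
      p∤rest    : ¬ p ∣ rest

  split : ∀ {p} → Prime p → ∀ n → 1 ≤ n → Splitting p n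
  split {p} p-prime = <-rec (λ n → 1 ≤ n → Splitting p n) step
    where
    step : ∀ n → (∀ {m} → m < n → 1 ≤ m → Splitting p m) → 1 ≤ n → Splitting p n
    step n rec 1≤n with p ∣? n
    ... | no p∤n                        = splitting 0 n (sym (*-identityˡ n)) p∤n
    ... | yes (divides zero n≡0)        = ⊥-elim (<-irrefl (sym n≡0) 1≤n)
    ... | yes (divides q@(suc _) n≡q*p)
      with rec (subst (q <_) (sym n≡q*p) (m<m*n q p (prime⇒>1 p-prime))) (s≤s z≤n)
    ...   | splitting e r q≡pᵉ*r p∤r = splitting (suc e) r n≡pᵉ⁺¹*r p∤r
      where
      n≡pᵉ⁺¹*r : n ≡ p ^ suc e * r
      n≡pᵉ⁺¹*r = begin
        n                ≡⟨ n≡q*p ⟩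
        q * p            ≡⟨ *-comm q p ⟩
        p * q            ≡⟨ cong (p *_) q≡pᵉ*r ⟩
        p * (p ^ e * r)  ≡⟨ *-assoc p (p ^ e) r ⟨
        p ^ suc e * r    ∎
        where open ≡.≡-Reasoning

  ∈-range1⁺ : ∀ {x N} → 1 ≤ x → x ≤ N → x ∈ range1 N
  ∈-range1⁺ {suc x} (s≤s _) x≤N = ∈-map⁺ suc (∈-upTo⁺ x≤N)

  ∈-range1⁻ : ∀ {x N} → x ∈ range1 N → 1 ≤ x × x ≤ N
  ∈-range1⁻ x∈ with ∈-map⁻ suc x∈
  ... | y , y∈ , refl = s≤s z≤n , ∈-upTo⁻ y∈

  range1-unique : ∀ N → Unique (range1 N)
  range1-unique N = Unique.map⁺ suc-injective (Unique.upTo⁺ N)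

  range1-suc : ∀ N → range1 (suc N) ≡ range1 N ++ [ suc N ]
  range1-suc N = trans (cong (map suc) (sym (List.upTo-∷ʳ N))) (List.map-++ suc (upTo N) [ N ])

  length-filter-range1 : ∀ {P : Pred ℕ 0ℓ} (P? : Decidable P) v →
                         (∀ {a} → 1 ≤ a → P a → a ≤ v) → (∀ {a} → 1 ≤ a → a ≤ v → P a) →
                         ∀ N → length (filter P? (range1 N)) ≡ N ⊓ v
  length-filter-range1 P? v P⇒≤ ≤⇒P zero    = refl
  length-filter-range1 P? v P⇒≤ ≤⇒P (suc N) = begin
    length (filter P? (range1 (suc N)))
      ≡⟨ cong (length ∘ filter P?) (range1-suc N) ⟩
    length (filter P? (range1 N ++ [ suc N ]))
      ≡⟨ cong length (List.filter-++ P? (range1 N) [ suc N ]) ⟩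
    length (filter P? (range1 N) ++ filter P? [ suc N ])
      ≡⟨ List.length-++ (filter P? (range1 N)) ⟩
    length (filter P? (range1 N)) + length (filter P? [ suc N ])
      ≡⟨ cong (_+ _) (length-filter-range1 P? v P⇒≤ ≤⇒P N) ⟩
    N ⊓ v + length (filter P? [ suc N ])
      ≡⟨ last-step ⟩
    suc N ⊓ v
      ∎
    where
    open ≡.≡-Reasoning
    last-step : N ⊓ v + length (filter P? [ suc N ]) ≡ suc N ⊓ v
    last-step with P? (suc N)
    ... | yes P[N+1] = let N<v = P⇒≤ (s≤s z≤n) P[N+1] in
      trans (+-comm (N ⊓ v) 1) (trans (cong suc (m≤n⇒m⊓n≡m (<⇒≤ N<v))) (sym (m≤n⇒m⊓n≡m N<v)))
    ... | no ¬P[N+1] with suc N ≤? v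
    ...   | yes N<v = ⊥-elim (¬P[N+1] (≤⇒P (s≤s z≤n) N<v))
    ...   | no N≮v  = let v≤N = ≤-pred (≰⇒> N≮v) in
      trans (+-identityʳ (N ⊓ v)) (trans (m≥n⇒m⊓n≡n v≤N) (sym (m≥n⇒m⊓n≡n (m≤n⇒m≤1+n v≤N))))

  ∈⇒≤foldr-⊔ : ∀ {x xs} → x ∈ xs → x ≤ foldr _⊔_ 0 xs
  ∈⇒≤foldr-⊔ {x} {y ∷ ys} (here refl) = m≤m⊔n x _
  ∈⇒≤foldr-⊔ {x} {y ∷ ys} (there x∈) = ≤-trans (∈⇒≤foldr-⊔ x∈) (m≤n⊔m y _)

  foldr-⊔-lub : ∀ {b} xs → (∀ {x} → x ∈ xs → x ≤ b) → foldr _⊔_ 0 xs ≤ b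
  foldr-⊔-lub []       _      = z≤n
  foldr-⊔-lub (x ∷ xs) all≤b = ⊔-lub (all≤b (here refl)) (foldr-⊔-lub xs (all≤b ∘ there))

  ↭-from-∈ : ∀ {xs ys : List ℕ} → Unique xs → Unique ys →
             (∀ {x} → x ∈ xs → x ∈ ys) → (∀ {x} → x ∈ ys → x ∈ xs) → xs ↭ ys
  ↭-from-∈ xs-unique ys-unique xs⊆ys ys⊆xs = ∼bag⇒↭ (mk↔ₛ′ xs⊆ys ys⊆xs
    (λ _ → unique⇒irrelevant (≡.setoid ℕ) ≡-irrelevant ys-unique _ _)
    (λ _ → unique⇒irrelevant (≡.setoid ℕ) ≡-irrelevant xs-unique _ _))

  module _ (e : ℕ → ℕ) where

    prime∤∏prime^ : ∀ {p ws} → Prime p → All Prime ws → p ∉ ws → ¬ p ∣ product (map (λ w → w ^ e w) ws)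
    prime∤∏prime^ {ws = []}     p-prime []               p∉ws p∣1 =
      <-irrefl (sym (∣1⇒≡1 p∣1)) (prime⇒>1 p-prime)
    prime∤∏prime^ {ws = w ∷ ws} p-prime (w-prime ∷ ws-prime) p∉ws p∣∏
      with euclidsLemma (w ^ e w) (product (map (λ w → w ^ e w) ws)) p-prime p∣∏
    ... | inj₁ p∣wᵉ = p∉ws (here (prime∣prime⇒≡ p-prime w-prime (prime∣^⇒∣ w (e w) p-prime p∣wᵉ)))
    ... | inj₂ p∣∏′ = prime∤∏prime^ p-prime ws-prime (p∉ws ∘ there) p∣∏′

    ∏prime^-split : ∀ {p ws} → Prime p → All Prime ws → Unique ws → p ∈ ws →
                    ∃ λ r → product (map (λ w → w ^ e w) ws) ≡ p ^ e p * r × ¬ p ∣ r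
    ∏prime^-split {ws = w ∷ ws} p-prime (_ ∷ ws-prime) (w∉ws ∷ unique) (here refl) =
      _ , refl , prime∤∏prime^ p-prime ws-prime (Unique.Unique[x∷xs]⇒x∉xs (w∉ws ∷ unique))
    ∏prime^-split {p} {w ∷ ws} p-prime (w-prime ∷ ws-prime) (w∉ws ∷ unique) (there p∈ws)
      with ∏prime^-split p-prime ws-prime unique p∈ws
    ... | r , ∏≡pᵉ*r , p∤r = w ^ e w * r , ∏′≡pᵉ*r′ , p∤r′
      where
      ∏′≡pᵉ*r′ : w ^ e w * product (map (λ w → w ^ e w) ws) ≡ p ^ e p * (w ^ e w * r)
      ∏′≡pᵉ*r′ = trans (cong (w ^ e w *_) ∏≡pᵉ*r) (x∙yz≈y∙xz (w ^ e w) (p ^ e p) r)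
        where open CommSemigroupProperties *-commutativeSemigroup using (x∙yz≈y∙xz)
      p∤r′ : ¬ p ∣ w ^ e w * r
      p∤r′ p∣wᵉr with euclidsLemma (w ^ e w) r p-prime p∣wᵉr
      ... | inj₁ p∣wᵉ = Unique.Unique[x∷xs]⇒x∉xs (w∉ws ∷ unique) (subst (_∈ ws) p≡w p∈ws)
        where p≡w = prime∣prime⇒≡ p-prime w-prime (prime∣^⇒∣ w (e w) p-prime p∣wᵉ)
      ... | inj₂ p∣r  = p∤r p∣r

  -- {1,…,κm} = { j + κk : 1 ≤ j ≤ κ, k < m }

  module ResidueBlocks {κ : ℕ} (1≤κ : 1 ≤ κ) (m : ℕ) where

    instance
      κ-nonZero : NonZero κ
      κ-nonZero = >-nonZero 1≤κ

    blocks : List ℕ → List ℕ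
    blocks js = cartesianProductWith (λ j k → j + κ * k) js (upTo m)

    InResidueRange : ℕ → Set
    InResidueRange j = 1 ≤ j × j ≤ κ

    division : ∀ {x} → 1 ≤ x → x ≤ κ * m → ∃₂ λ j k → InResidueRange j × k < m × x ≡ j + κ * k
    division {suc x} _ x<κm = suc (x % κ) , x / κ , (s≤s z≤n , m%n<n x κ) , x/κ<m , cong suc x≡
      where
      x≡ : x ≡ x % κ + κ * (x / κ)
      x≡ = trans (m≡m%n+[m/n]*n x κ) (cong (x % κ +_) (*-comm (x / κ) κ))
      x/κ<m : x / κ < m
      x/κ<m = m<n*o⇒m/o<n (subst (x <_) (*-comm κ m) x<κm)

    j+κk-bounds : ∀ {j k} → InResidueRange j → k < m → 1 ≤ j + κ * k × j + κ * k ≤ κ * m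
    j+κk-bounds {j} {k} (1≤j , j≤κ) k<m = ≤-trans 1≤j (m≤m+n j (κ * k)) , (begin
      j + κ * k  ≤⟨ +-monoˡ-≤ (κ * k) j≤κ ⟩
      κ + κ * k  ≡⟨ *-suc κ k ⟨
      κ * suc k  ≤⟨ *-monoʳ-≤ κ k<m ⟩
      κ * m      ∎)
      where open ≤-Reasoning

    residue-unique : ∀ {j j′ k k′} → InResidueRange j → InResidueRange j′ →
                     j + κ * k ≡ j′ + κ * k′ → j ≡ j′
    residue-unique {suc r} {suc r′} {k} {k′} (_ , r<κ) (_ , r′<κ) eq = cong suc (begin
      r                  ≡⟨ m<n⇒m%n≡m r<κ ⟨
      r % κ              ≡⟨ [m+kn]%n≡m%n r k κ ⟨
      (r + k * κ) % κ    ≡⟨ %-congˡ r+kκ≡r′+k′κ ⟩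
      (r′ + k′ * κ) % κ  ≡⟨ [m+kn]%n≡m%n r′ k′ κ ⟩
      r′ % κ             ≡⟨ m<n⇒m%n≡m r′<κ ⟩
      r′                 ∎)
      where
      open ≡.≡-Reasoning
      r+kκ≡r′+k′κ : r + k * κ ≡ r′ + k′ * κ
      r+kκ≡r′+k′κ = trans (cong (r +_) (*-comm k κ)) (trans (suc-injective eq) (cong (r′ +_) (*-comm κ k′)))

    blocks-unique : ∀ {js} → All InResidueRange js → Unique js → Unique (blocks js)
    blocks-unique {[]}     _                  _               = []
    blocks-unique {j ∷ js} (j-range ∷ ranges) (j∉js ∷ unique) =
      Unique.++⁺ (Unique.map⁺ j+κ-injective (Unique.upTo⁺ m)) (blocks-unique ranges unique) disjoint
      where
      j+κ-injective : ∀ {k k′} → j + κ * k ≡ j + κ * k′ → k ≡ k′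
      j+κ-injective eq = *-cancelˡ-≡ _ _ κ (+-cancelˡ-≡ j _ _ eq)
      disjoint : ∀ {x} → ¬ (x ∈ map (λ k → j + κ * k) (upTo m) × x ∈ blocks js)
      disjoint (x∈block , x∈blocks) with ∈-map⁻ (λ k → j + κ * k) x∈block
                                        | ∈-cartesianProductWith⁻ (λ j k → j + κ * k) js (upTo m) x∈blocks
      ... | k , _ , refl | j′ , k′ , j′∈js , _ , eq =
        Unique.Unique[x∷xs]⇒x∉xs (j∉js ∷ unique)
          (subst (_∈ js) (sym (residue-unique j-range (All.lookup ranges j′∈js) eq)) j′∈js)

module RegularSystemProperties (A : RegularSystem) where

  open RegularSystem A
  open import Data.Nat
  open import Data.Nat.Properties
  open import Data.Nat.Divisibility
  open import Data.Nat.Primality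
  open import Data.Nat.Induction using (<-rec)
  open import Data.List.Membership.Propositional using (_∈_)
  open import Data.List.Membership.Propositional.Properties
    using (∈-filter⁺; ∈-filter⁻; ∈-upTo⁺; ∈-upTo⁻; ∈-cartesianProductWith⁺; ∈-cartesianProductWith⁻)
  open import Data.List.Relation.Unary.Unique.Propositional using (Unique)
  import Data.List.Relation.Unary.All as All
  import Data.List.Relation.Unary.All.Properties as All
  import Data.List.Relation.Unary.Unique.Propositional.Properties as Unique
  open import Data.Product using (∃; ∃₂)
  open import Function.Bundles using (_⇔_; mk⇔; Equivalence)
  import Function.Properties.Equivalence as ⇔
  open import Relation.Nullary using (yes; no)
  open import Relation.Nullary.Decidable using (_×-dec_)
  open ≡ using (refl; sym; trans; cong; subst)
  open Arithmetic

  typeAt : ℕ → ℕ → ℕ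
  typeAt p n = type p (val A p n)

  val≡exponent : ∀ {p n} → Prime p → (s : Splitting p n) → val A p n ≡ Splitting.exponent s
  val≡exponent {p} {n} p-prime (splitting e r n≡pᵉ*r p∤r) =
    trans (length-filter-range1 (λ a → p ^ a ∣? n) e pᵃ∣n⇒a≤e a≤e⇒pᵃ∣n n) (m≥n⇒m⊓n≡n e≤n)
    where
    1≤p : 1 ≤ p
    1≤p = <⇒≤ (prime⇒>1 p-prime)
    pᵃ∣n⇒a≤e : ∀ {a} → 1 ≤ a → p ^ a ∣ n → a ≤ e
    pᵃ∣n⇒a≤e {a} _ pᵃ∣n with a ≤? e
    ... | yes a≤e = a≤e
    ... | no  a≰e = ⊥-elim (p∤r (*-cancelˡ-∣ (p ^ e) {{m^n≢0 p e {{>-nonZero 1≤p}}}} pᵉ*p∣pᵉ*r))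
      where
      pᵉ*p∣pᵉ*r : p ^ e * p ∣ p ^ e * r
      pᵉ*p∣pᵉ*r = subst₂ _∣_ (*-comm p (p ^ e)) n≡pᵉ*r (∣-trans (^-monoʳ-∣ p (≰⇒> a≰e)) pᵃ∣n)
        where open ≡ using (subst₂)
    a≤e⇒pᵃ∣n : ∀ {a} → 1 ≤ a → a ≤ e → p ^ a ∣ n
    a≤e⇒pᵃ∣n _ a≤e = subst (_ ∣_) (sym n≡pᵉ*r) (∣-trans (^-monoʳ-∣ p a≤e) (m∣m*n r))
    e≤n : e ≤ n
    e≤n = begin
      e          ≤⟨ <⇒≤ (n<m^n e (prime⇒>1 p-prime)) ⟩
      p ^ e      ≤⟨ m≤m*n (p ^ e) r {{≢-nonZero λ r≡0 → p∤r (subst (p ∣_) (sym r≡0) (p ∣0))}} ⟩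
      p ^ e * r  ≡⟨ n≡pᵉ*r ⟨
      n          ∎
      where open ≤-Reasoning

  type≥1 : ∀ {p a} → Prime p → 1 ≤ a → 1 ≤ type p a
  type≥1 {p} {a} p-prime 1≤a with type p a | type-∣ p a p-prime 1≤a
  ... | zero  | 0∣a = ⊥-elim (<-irrefl (sym (0∣⇒≡0 0∣a)) 1≤a)
  ... | suc _ | _   = s≤s z≤n

  module PrimePower {p a : ℕ} (p-prime : Prime p) (1≤a : 1 ≤ a) where

    private
      t = type p a
      q = _∣_.quotient (type-∣ p a p-prime 1≤a)
      a≡q*t : a ≡ q * t
      a≡q*t = _∣_.equality (type-∣ p a p-prime 1≤a)
      spec = type-spec p a p-prime 1≤a q (≤-reflexive (sym a≡q*t))

    In-^⁻ : ∀ {d} → In (p ^ a) d → ∃ λ r → d ≡ p ^ (r * t)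
    In-^⁻ {d} d∈ with proj₁ (spec d) (subst (λ b → In (p ^ b) d) a≡q*t d∈)
    ... | r , _ , d≡ = r , d≡

    private
      In-^⁺ : ∀ r → r ≤ q → In (p ^ a) (p ^ (r * t))
      In-^⁺ r r≤q = subst (λ b → In (p ^ b) (p ^ (r * t))) (sym a≡q*t)
                          (proj₂ (spec (p ^ (r * t))) (r , r≤q , refl))

    1∈A[pᵃ] : In (p ^ a) 1
    1∈A[pᵃ] = In-^⁺ 0 z≤n

    pᵗ∈A[pᵃ] : In (p ^ a) (p ^ t)
    pᵗ∈A[pᵃ] = subst (In (p ^ a) ∘ (p ^_)) (*-identityˡ t) (In-^⁺ 1 1≤q)
      where
      1≤q : 1 ≤ q
      1≤q with q | a≡q*t
      ... | zero  | a≡0 = ⊥-elim (<-irrefl (sym a≡0) 1≤a)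
      ... | suc _ | _   = s≤s z≤n

  -- A(pᵗ) = {1, pᵗ} for t = t_A(pᵃ), so t_A(pᵗ) = t
  type-idempotent : ∀ {p a} → Prime p → 1 ≤ a → type p (type p a) ≡ type p a
  type-idempotent {p} {a} p-prime 1≤a =
    t′≡t (proj₁ (type-spec p a p-prime 1≤a 1 1*t≤a (p ^ t′)) pᵗ′∈A[pᵗ])
    where
    t  = type p a
    t′ = type p t
    1<p = prime⇒>1 p-prime
    1≤t = type≥1 p-prime 1≤a
    1*t≤a : 1 * t ≤ a
    1*t≤a = subst (_≤ a) (sym (*-identityˡ t)) (∣⇒≤ {{>-nonZero 1≤a}} (type-∣ p a p-prime 1≤a))
    pᵗ′∈A[pᵗ] : In (p ^ (1 * t)) (p ^ t′)
    pᵗ′∈A[pᵗ] = subst (λ b → In (p ^ b) (p ^ t′)) (sym (*-identityˡ t)) (PrimePower.pᵗ∈A[pᵃ] p-prime 1≤t)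
    t′≡t : (∃ λ r → r ≤ 1 × p ^ t′ ≡ p ^ (r * t)) → t′ ≡ t
    t′≡t (zero        , _      , pᵗ′≡1)  = ⊥-elim (<-irrefl (sym (^-injectiveʳ 1<p pᵗ′≡1)) (type≥1 p-prime 1≤t))
    t′≡t (suc zero    , _      , pᵗ′≡pᵗ) = trans (^-injectiveʳ 1<p pᵗ′≡pᵗ) (*-identityˡ t)
    t′≡t (suc (suc _) , s≤s () , _)

  module AtPrime {p n : ℕ} (p-prime : Prime p) (1≤n : 1 ≤ n) (p∣n : p ∣ n) where

    open Splitting (split p-prime n 1≤n) public using (rest; p∤rest) renaming (exponent to e)
    open Splitting (split p-prime n 1≤n) using (n≡pᵉ*rest)

    1≤e : 1 ≤ e
    1≤e with e | n≡pᵉ*rest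
    ... | zero  | n≡1*rest = ⊥-elim (p∤rest (subst (p ∣_) (trans n≡1*rest (*-identityˡ rest)) p∣n))
    ... | suc _ | _        = s≤s z≤n

    typeAt≡ : typeAt p n ≡ type p e
    typeAt≡ = cong (type p) (val≡exponent p-prime (split p-prime n 1≤n))

    private
      1≤pᵉ : 1 ≤ p ^ e
      1≤pᵉ = m^n>0 p {{>-nonZero (<⇒≤ (prime⇒>1 p-prime))}} e
      split-mult = mult (p ^ e) rest 1≤pᵉ (¬∣⇒≥1 p∤rest) (prime∤⇒coprime-^ e p-prime p∤rest)

    In⁻ : ∀ {d} → In n d → ∃₂ λ d₁ d₂ → In (p ^ e) d₁ × In rest d₂ × d ≡ d₁ * d₂
    In⁻ {d} d∈A[n] = proj₁ (split-mult d) (subst (λ m → In m d) n≡pᵉ*rest d∈A[n])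

    In⁺ : ∀ {d₁ d₂} → In (p ^ e) d₁ → In rest d₂ → In n (d₁ * d₂)
    In⁺ {d₁} {d₂} d₁∈ d₂∈ = subst (λ m → In m (d₁ * d₂)) (sym n≡pᵉ*rest)
                                  (proj₂ (split-mult (d₁ * d₂)) (d₁ , d₂ , d₁∈ , d₂∈ , refl))

    rest<n : rest < n
    rest<n = begin-strict
      rest          ≡⟨ *-identityˡ rest ⟨
      1 * rest      <⟨ *-monoˡ-< rest {{>-nonZero (¬∣⇒≥1 p∤rest)}} 1<pᵉ ⟩
      p ^ e * rest  ≡⟨ n≡pᵉ*rest ⟨
      n             ∎
      where
      open ≤-Reasoning
      1<pᵉ : 1 < p ^ e
      1<pᵉ = <-≤-trans (prime⇒>1 p-prime) (subst (_≤ p ^ e) (*-identityʳ p)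
                         (^-monoʳ-≤ p {{>-nonZero (<⇒≤ (prime⇒>1 p-prime))}} 1≤e))

  1∈A : ∀ n → 1 ≤ n → In n 1
  1∈A = <-rec (λ n → 1 ≤ n → In n 1) step
    where
    step : ∀ n → (∀ {m} → m < n → 1 ≤ m → In m 1) → 1 ≤ n → In n 1
    step (suc zero)      _   _   = proj₂ (one 1) refl
    step n@(suc (suc _)) rec 1≤n with ∃prime∣ n (s≤s (s≤s z≤n))
    ... | p , p-prime , p∣n =
      In⁺ (PrimePower.1∈A[pᵃ] p-prime 1≤e) (rec rest<n (¬∣⇒≥1 p∤rest))
      where open AtPrime p-prime 1≤n p∣n

  p^typeAt∈A : ∀ {p n} → Prime p → 1 ≤ n → p ∣ n → In n (p ^ typeAt p n)
  p^typeAt∈A {p} {n} p-prime 1≤n p∣n =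
    subst (In n) (trans (*-identityʳ _) (cong (p ^_) (sym typeAt≡)))
          (In⁺ (PrimePower.pᵗ∈A[pᵃ] p-prime 1≤e) (1∈A rest (¬∣⇒≥1 p∤rest)))
    where open AtPrime p-prime 1≤n p∣n

  1<p^typeAt : ∀ {p n} → Prime p → 1 ≤ n → p ∣ n → 1 < p ^ typeAt p n
  1<p^typeAt {p} {n} p-prime 1≤n p∣n =
    subst (λ t → 1 < p ^ t) (sym typeAt≡) (^-monoʳ-< p (prime⇒>1 p-prime) (type≥1 p-prime 1≤e))
    where open AtPrime p-prime 1≤n p∣n

  In⇒p^typeAt∣ : ∀ {n d} → 1 ≤ n → In n d → 1 < d → ∃ λ p → Prime p × p ∣ n × p ^ typeAt p n ∣ d
  In⇒p^typeAt∣ {n} {d} 1≤n d∈A[n] 1<d with ∃prime∣ d 1<d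
  ... | p , p-prime , p∣d = p , p-prime , p∣n , p^typeAt∣d
    where
    p∣n = ∣-trans p∣d (In-∣ d∈A[n])
    open AtPrime p-prime 1≤n p∣n
    p^typeAt∣d : p ^ typeAt p n ∣ d
    p^typeAt∣d with In⁻ d∈A[n]
    ... | d₁ , d₂ , d₁∈ , d₂∈ , d≡d₁d₂ with PrimePower.In-^⁻ p-prime 1≤e d₁∈
    ...   | zero  , d₁≡1 = ⊥-elim (p∤rest (∣-trans (subst (p ∣_) d≡d₂ p∣d) (In-∣ d₂∈)))
      where
      d≡d₂ : d ≡ d₂
      d≡d₂ = trans d≡d₁d₂ (trans (cong (_* d₂) d₁≡1) (*-identityˡ d₂))
    ...   | suc r , d₁≡pᵗ⁺ʳᵗ = subst (λ t → p ^ t ∣ d) (sym typeAt≡) (∣-trans pᵗ∣d₁ d₁∣d)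
      where
      t = type p e
      pᵗ∣d₁ : p ^ t ∣ d₁
      pᵗ∣d₁ = subst (p ^ t ∣_) (sym d₁≡pᵗ⁺ʳᵗ) (^-monoʳ-∣ p (m≤m+n t (r * t)))
      d₁∣d : d₁ ∣ d
      d₁∣d = subst (d₁ ∣_) (sym d≡d₁d₂) (m∣m*n d₂)

  gcdA≡1⇔ : ∀ {n} j → 1 ≤ n → gcdA A j n ≡ 1 ⇔ (∀ {d} → In n d → d ∣ j → d ≤ 1)
  gcdA≡1⇔ {n} j 1≤n = mk⇔ to from
    where
    divisorsA? = λ d → (d ∣? j) ×-dec In? n d
    ∈-divisorsA : ∀ {d} → In n d → d ∣ j → d ∈ filter divisorsA? (range1 n)
    ∈-divisorsA d∈A[n] d∣j =
      ∈-filter⁺ divisorsA? (∈-range1⁺ (In-pos d∈A[n]) (∣⇒≤ {{>-nonZero 1≤n}} (In-∣ d∈A[n]))) (d∣j , d∈A[n])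
    to : gcdA A j n ≡ 1 → ∀ {d} → In n d → d ∣ j → d ≤ 1
    to gcd≡1 d∈A[n] d∣j = subst (_ ≤_) gcd≡1 (∈⇒≤foldr-⊔ (∈-divisorsA d∈A[n] d∣j))
    from : (∀ {d} → In n d → d ∣ j → d ≤ 1) → gcdA A j n ≡ 1
    from all≤1 = ≤-antisym
      (foldr-⊔-lub _ λ d∈ → let _ , d∣j , d∈A[n] = ∈-filter⁻ divisorsA? {xs = range1 n} d∈
                             in all≤1 d∈A[n] d∣j)
      (∈⇒≤foldr-⊔ (∈-divisorsA (1∈A n 1≤n) (1∣ j)))

  TypeCoprime : ℕ → ℕ → Set
  TypeCoprime n j = ∀ {p} → Prime p → p ∣ n → ¬ p ^ typeAt p n ∣ j

  -- The p^{t_A(pᵃ)} with pᵃ ∥ n are exactly the minimal members of A(n) ∖ {1}.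
  gcdA≡1⇔TypeCoprime : ∀ {n} j → 1 ≤ n → gcdA A j n ≡ 1 ⇔ TypeCoprime n j
  gcdA≡1⇔TypeCoprime {n} j 1≤n = mk⇔ to from
    where
    open Equivalence (gcdA≡1⇔ j 1≤n) renaming (to to gcd≡1⇒A-divisors≤1; from to A-divisors≤1⇒gcd≡1)
    to : gcdA A j n ≡ 1 → TypeCoprime n j
    to gcd≡1 p-prime p∣n p^t∣j =
      <⇒≱ (1<p^typeAt p-prime 1≤n p∣n) (gcd≡1⇒A-divisors≤1 gcd≡1 (p^typeAt∈A p-prime 1≤n p∣n) p^t∣j)
    from : TypeCoprime n j → gcdA A j n ≡ 1
    from coprime = A-divisors≤1⇒gcd≡1 A-divisor≤1
      where
      A-divisor≤1 : ∀ {d} → In n d → d ∣ j → d ≤ 1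
      A-divisor≤1 {d} d∈A[n] d∣j with 1 <? d
      ... | no  d≯1 = ≮⇒≥ d≯1
      ... | yes 1<d with In⇒p^typeAt∣ 1≤n d∈A[n] 1<d
      ...   | p , p-prime , p∣n , p^t∣d = ⊥-elim (coprime p-prime p∣n (∣-trans p^t∣d d∣j))

  module Kernel {n : ℕ} (1≤n : 1 ≤ n) where

    kappa-split : ∀ {p} → Prime p → p ∣ n → ∃ λ r → kappa A n ≡ p ^ typeAt p n * r × ¬ p ∣ r
    kappa-split {p} p-prime p∣n =
      ∏prime^-split (λ w → typeAt w n) p-prime
        (All.map proj₁ (All.all-filter prime∣n? (range1 n)))
        (Unique.filter⁺ prime∣n? (range1-unique n))
        (∈-filter⁺ prime∣n? (∈-range1⁺ (<⇒≤ (prime⇒>1 p-prime)) (∣⇒≤ {{>-nonZero 1≤n}} p∣n)) (p-prime , p∣n))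
      where prime∣n? = λ q → prime? q ×-dec (q ∣? n)

    p^typeAt∣kappa : ∀ {p} → Prime p → p ∣ n → p ^ typeAt p n ∣ kappa A n
    p^typeAt∣kappa {p} p-prime p∣n with kappa-split p-prime p∣n
    ... | r , κ≡ , _ = subst (p ^ typeAt p n ∣_) (sym κ≡) (m∣m*n r)

    prime∣⇒∣kappa : ∀ {p} → Prime p → p ∣ n → p ∣ kappa A n
    prime∣⇒∣kappa {p} p-prime p∣n =
      ∣-trans (subst (_∣ p ^ typeAt p n) (*-identityʳ p) (^-monoʳ-∣ p 1≤t)) (p^typeAt∣kappa p-prime p∣n)
      where
      open AtPrime p-prime 1≤n p∣n
      1≤t : 1 ≤ typeAt p n
      1≤t = subst (1 ≤_) (sym typeAt≡) (type≥1 p-prime 1≤e)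

    typeAt-kappa : ∀ {p} → Prime p → p ∣ n → typeAt p (kappa A n) ≡ typeAt p n
    typeAt-kappa {p} p-prime p∣n with kappa-split p-prime p∣n
    ... | r , κ≡ , p∤r = begin
      type p (val A p (kappa A n))  ≡⟨ cong (type p) (val≡exponent p-prime (splitting (typeAt p n) r κ≡ p∤r)) ⟩
      type p (typeAt p n)           ≡⟨ cong (type p ∘ type p) (val≡exponent p-prime (split p-prime n 1≤n)) ⟩
      type p (type p e)             ≡⟨ type-idempotent p-prime 1≤e ⟩
      type p e                      ≡⟨ typeAt≡ ⟨
      typeAt p n                    ∎
      where
      open ≡.≡-Reasoning
      open AtPrime p-prime 1≤n p∣n

    TypeCoprime-kappa : kappa A n ∣ n → ∀ j → TypeCoprime n j ⇔ TypeCoprime (kappa A n) j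
    TypeCoprime-kappa κ∣n j = mk⇔
      (λ coprime {p} p-prime p∣κ p^t∣j →
        let p∣n = ∣-trans p∣κ κ∣n in
        coprime p-prime p∣n (subst (λ t → p ^ t ∣ j) (typeAt-kappa p-prime p∣n) p^t∣j))
      (λ coprime {p} p-prime p∣n p^t∣j →
        coprime p-prime (prime∣⇒∣kappa p-prime p∣n)
          (subst (λ t → p ^ t ∣ j) (sym (typeAt-kappa p-prime p∣n)) p^t∣j))

    TypeCoprime-periodic : ∀ j k → TypeCoprime n (j + kappa A n * k) ⇔ TypeCoprime n j
    TypeCoprime-periodic j k = mk⇔
      (λ coprime {p} p-prime p∣n p^t∣j →
        coprime p-prime p∣n (∣m∣n⇒∣m+n p^t∣j (p^t∣κk p-prime p∣n)))
      (λ coprime {p} p-prime p∣n p^t∣j+κk →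
        coprime p-prime p∣n
          (∣m+n∣m⇒∣n (subst (p ^ typeAt p n ∣_) (+-comm j _) p^t∣j+κk) (p^t∣κk p-prime p∣n)))
      where
      p^t∣κk : ∀ {p} → Prime p → p ∣ n → p ^ typeAt p n ∣ kappa A n * k
      p^t∣κk p-prime p∣n = ∣-trans (p^typeAt∣kappa p-prime p∣n) (m∣m*n k)

  1≤kappa : ∀ {n m} → 1 ≤ n → n ≡ kappa A n * m → 1 ≤ kappa A n
  1≤kappa {n} {m} 1≤n n≡κm = n≢0⇒n>0 λ κ≡0 → <-irrefl (sym (trans n≡κm (cong (_* m) κ≡0))) 1≤n

  gcdA-reduce-kernel : ∀ {n m} → 1 ≤ n → n ≡ kappa A n * m → ∀ j k →
                       gcdA A (j + kappa A n * k) n ≡ 1 ⇔ gcdA A j (kappa A n) ≡ 1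
  gcdA-reduce-kernel {n} {m} 1≤n n≡κm j k =
    ⇔.trans (gcdA≡1⇔TypeCoprime (j + kappa A n * k) 1≤n)
      (⇔.trans (TypeCoprime-periodic j k)
        (⇔.trans (TypeCoprime-kappa κ∣n j) (⇔.sym (gcdA≡1⇔TypeCoprime j (1≤kappa 1≤n n≡κm)))))
    where
    open Kernel 1≤n
    κ∣n : kappa A n ∣ n
    κ∣n = divides m (trans n≡κm (*-comm _ m))

  residuesA : ℕ → List ℕ
  residuesA n = filter (λ j → gcdA A j n ≟ 1) (range1 n)

  residuesA⁺ : ∀ {n j} → 1 ≤ j → j ≤ n → gcdA A j n ≡ 1 → j ∈ residuesA n
  residuesA⁺ {n} 1≤j j≤n gcd≡1 = ∈-filter⁺ (λ j → gcdA A j n ≟ 1) (∈-range1⁺ 1≤j j≤n) gcd≡1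

  residuesA⁻ : ∀ {n j} → j ∈ residuesA n → (1 ≤ j × j ≤ n) × gcdA A j n ≡ 1
  residuesA⁻ {n} j∈ with ∈-filter⁻ (λ j → gcdA A j n ≟ 1) {xs = range1 n} j∈
  ... | j∈range , gcd≡1 = ∈-range1⁻ j∈range , gcd≡1

  residuesA-unique : ∀ n → Unique (residuesA n)
  residuesA-unique n = Unique.filter⁺ (λ j → gcdA A j n ≟ 1) (range1-unique n)

  residuesA-↭-blocks : ∀ {n m} (1≤n : 1 ≤ n) (n≡κm : n ≡ kappa A n * m) →
                       residuesA n ↭ ResidueBlocks.blocks (1≤kappa 1≤n n≡κm) m (residuesA (kappa A n))
  residuesA-↭-blocks {n} {m} 1≤n n≡κm =
    ↭-from-∈ (residuesA-unique n)
      (blocks-unique (All.tabulate (proj₁ ∘ residuesA⁻ {κ})) (residuesA-unique κ)) to from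
    where
    κ = kappa A n
    open ResidueBlocks (1≤kappa 1≤n n≡κm) m
    reduce = gcdA-reduce-kernel 1≤n n≡κm
    to : ∀ {x} → x ∈ residuesA n → x ∈ blocks (residuesA κ)
    to {x} x∈ with residuesA⁻ x∈
    ... | (1≤x , x≤n) , gcd≡1 with division 1≤x (subst (x ≤_) n≡κm x≤n)
    ...   | j , k , (1≤j , j≤κ) , k<m , refl =
      ∈-cartesianProductWith⁺ (λ j k → j + κ * k)
        (residuesA⁺ 1≤j j≤κ (Equivalence.to (reduce j k) gcd≡1)) (∈-upTo⁺ k<m)
    from : ∀ {x} → x ∈ blocks (residuesA κ) → x ∈ residuesA n
    from x∈ with ∈-cartesianProductWith⁻ (λ j k → j + κ * k) (residuesA κ) (upTo m) x∈
    ... | j , k , j∈ , k∈ , refl with j+κk-bounds (proj₁ (residuesA⁻ {κ} j∈)) (∈-upTo⁻ k∈)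
    ...   | 1≤x , x≤κm =
      residuesA⁺ 1≤x (subst (j + κ * k ≤_) (sym n≡κm) x≤κm)
        (Equivalence.from (reduce j k) (proj₂ (residuesA⁻ {κ} j∈)))

open import Data.Nat using (_+_; _*_; _≤_)

corollary3 : ∀ {c ℓ} (R : CommutativeRing c ℓ) → Poly.IsDomain R →
    (A : RegularSystem) (n : ℕ) → 1 ≤ n →
    (ζ : CommutativeRing.Carrier R) → Poly.IsPrimitiveRoot R n ζ →
    (m : ℕ) → n ≡ kappa A n * m →
    Poly._≈P_ R (Poly.PhiA R A ζ n)
      (Poly.compose R (Poly.PhiA R A (Poly.pow R ζ m) (kappa A n)) (Poly.xpow R m))
corollary3 R domain A n 1≤n ζ ζ-primitive zero    n≡κ*0 =
  ⊥-elim (ℕ.<-irrefl (≡.sym (≡.trans n≡κ*0 (ℕ.*-zeroʳ (kappa A n)))) 1≤n)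
corollary3 R domain A n 1≤n ζ ζ-primitive m@(suc _) n≡κm = get (begin
  prodP (map lin (residuesA n))
    ≈⟨ prodP-↭ (↭.map⁺ lin (residuesA-↭-blocks 1≤n n≡κm)) ⟩
  prodP (map lin (blocks (residuesA κ)))
    ≈⟨ prodP-cartesianProductWith lin (λ j k → j + κ * k) (residuesA κ) (upTo m) ⟩
  prodP (map (λ j → prodP (map (λ k → lin (j + κ * k)) (upTo m))) (residuesA κ))
    ≈⟨ prodP-map-cong (xᵐ-ζᵐʲ≋∏x-ζʲ⁺ᵏᵏ 1≤κ ζ-primitive′) (residuesA κ) ⟨
  prodP (map (λ j → compose (linear (pow (pow ζ m) j)) (xpow m)) (residuesA κ))
    ≡⟨ ≡.cong prodP (List.map-∘ (residuesA κ)) ⟩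
  prodP (map (λ p → compose p (xpow m)) (map (linear ∘ pow (pow ζ m)) (residuesA κ)))
    ≈⟨ compose-prodP (map (linear ∘ pow (pow ζ m)) (residuesA κ)) (xpow m) ⟨
  compose (PhiA A (pow ζ m) κ) (xpow m)
    ∎)
  where
  open Poly R
  open PolynomialArithmetic R
  open RootsOfUnity R domain
  open RegularSystemProperties A
  open ≋-Reasoning
  κ = kappa A n
  1≤κ = 1≤kappa 1≤n n≡κm
  open Arithmetic.ResidueBlocks 1≤κ m
  lin : ℕ → Pol
  lin = linear ∘ pow ζ
  ζ-primitive′ : IsPrimitiveRoot (κ * m) ζ
  ζ-primitive′ = ≡.subst (λ n → IsPrimitiveRoot n ζ) n≡κm ζ-primitive
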